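{- For all $n\in\mathbb{N}_0$, the expected total number of branches in a uniformly random binary tree of size $n$ is \[ \mathbb{E} X_{n} = \frac{n+1}{\binom{2n}{n}}\sum_{k=1}^{n+1} (2 - 2^{ -v_{2}(k)})\, k \bigg[\binom{2n}{n+1-k}-2\binom{2n}{n-k}+ \binom{2n}{n-1-k}\bigg], \] where $v_2(k)$ is the largest $\nu$ such that $2^\nu$ divides $k$, and binomial coefficients with negative lower index are $0$.
   Context: A binary tree is either a leaf $\square$ or an inner node with an ordered pair of binary subtrees; its size is the number of inner nodes, and all trees of size $n$ are equally likely. The register function is defined by $\mathrm{Reg}(\square)=0$ and, for a tree with subtrees $t_1,t_2$, $\mathrm{Reg}(t)=\max\{\mathrm{Reg}(t_1),\mathrm{Reg}(t_2)\}$ if these differ and $\mathrm{Reg}(t_1)+1$ otherwise. Label every node (inner node or leaf) by the register function of the subtree rooted there. An $r$-branch is a maximal connected set of nodes all labeled $r$. $X_n$ is the total number of branches (over all $r\ge0$) of a random tree of size $n$. -}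

module Defs where

open import Data.Nat as ℕ using (ℕ; zero; suc; _⊔_; _∸_; _^_; _≡ᵇ_)
open import Data.Nat.Combinatorics using (_C_)
open import Data.Nat.Divisibility using (_∣?_)
open import Data.Bool using (Bool; true; false; if_then_else_)
open import Data.Maybe using (Maybe; just; nothing)
open import Data.List using (List; []; _∷_; map; concatMap; cartesianProductWith; upTo; filterᵇ; foldr; length)
open import Data.Nat.ListAction using (sum)
open import Data.Integer as ℤ using (ℤ; +_)
open import Data.Rational as ℚ using (ℚ; 0ℚ)
open import Relation.Nullary.Decidable using (⌊_⌋)

data Tree : Set where
  leaf : Tree
  node : Tree → Tree → Tree

size : Tree → ℕ
size leaf       = 0
size (node l r) = suc (size l ℕ.+ size r)

-- treesF f n : all trees of size n (each exactly once), provided the fuel f ≥ n.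
-- A tree of size n+1 is node l r with size l = i, size r = n ∸ i, 0 ≤ i ≤ n.
treesF : ℕ → ℕ → List Tree
treesF _       zero    = leaf ∷ []
treesF zero    (suc n) = []
treesF (suc f) (suc n) =
  concatMap (λ i → cartesianProductWith node (treesF f i) (treesF f (n ∸ i))) (upTo (suc n))

trees : ℕ → List Tree
trees n = treesF n n

Reg : Tree → ℕ
Reg leaf = 0
Reg (node t₁ t₂) = if Reg t₁ ≡ᵇ Reg t₂ then suc (Reg t₁) else (Reg t₁ ⊔ Reg t₂)

-- Every node (inner node or leaf) is labelled by Reg of its
-- subtree.  An r-branch is a maximal connected set of nodes labelled r;
-- since the tree is rooted, each branch has a unique topmost node, namely a
-- node which is the root or whose parent carries a different label.  So the
-- number of branches is the number of such "branch tops".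
-- branchTops p t counts branch tops in the subtree t, where p is the label
-- of t's parent (nothing if t is the root of the whole tree).

branchTops : Maybe ℕ → Tree → ℕ
branchTops p t = top p ℕ.+ below t
  where
  top : Maybe ℕ → ℕ
  top nothing  = 1
  top (just r) = if r ≡ᵇ Reg t then 0 else 1
  below : Tree → ℕ
  below leaf = 0
  below (node t₁ t₂) = branchTops (just (Reg (node t₁ t₂))) t₁ ℕ.+ branchTops (just (Reg (node t₁ t₂))) t₂

branches : Tree → ℕ
branches t = branchTops nothing t

-- z / d as a rational; the case d = 0 never occurs below (conventionally 0).
_/ℕ_ : ℤ → ℕ → ℚ
z /ℕ zero  = 0ℚ
z /ℕ suc d = z ℚ./ suc d

-- Mean of a list of naturals (0 for the empty list, which never occurs below).
mean : List ℕ → ℚ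
mean xs = (+ sum xs) /ℕ length xs

EX : ℕ → ℚ
EX n = mean (map branches (trees n))

-- 2-adic valuation: v₂ k = largest ν with 2^ν ∣ k  (for k ≥ 1 such ν < k+1).
v₂ : ℕ → ℕ
v₂ k = foldr _⊔_ 0 (filterᵇ (λ ν → ⌊ (2 ^ ν) ∣? k ⌋) (upTo (suc k)))

binomℤ : ℕ → ℤ → ℤ
binomℤ m (+ j)      = + (m C j)
binomℤ m ℤ.-[1+ _ ] = + 0

summand : ℕ → ℕ → ℚ
summand n k =
  (((+ 2) /ℕ 1) ℚ.- ((+ 1) /ℕ (2 ^ v₂ k)))
  ℚ.* ((+ k ℤ.* (binomℤ (2 ℕ.* n) (+ (suc n) ℤ.- + k)
                 ℤ.- + 2 ℤ.* binomℤ (2 ℕ.* n) (+ n ℤ.- + k)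
                 ℤ.+ binomℤ (2 ℕ.* n) (+ n ℤ.- + 1 ℤ.- + k))) /ℕ 1)

sumFrom1 : ℕ → (ℕ → ℚ) → ℚ
sumFrom1 m f = foldr ℚ._+_ 0ℚ (map (λ i → f (suc i)) (upTo m))

RHS : ℕ → ℚ
RHS n = ((+ (suc n)) /ℕ ((2 ℕ.* n) C n)) ℚ.* sumFrom1 (suc n) (summand n)

-- Every branch has a unique lowest node: a leaf, or an inner node whose two subtrees have
-- equal register. Deleting the leaves of a tree t of size n ≥ 1 and contracting the unary
-- chains yields a tree t′ with X(t) = (n + 1) + X(t′), and exactly [zⁿ](z/(1−2z))^(2k+1)
-- trees of size n reduce to a given tree of size k. Summing over all trees of size n gives a
-- linear recursion for the branch totals with inhomogeneity (n + 1)·Cat(n) = C(2n, n), which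
-- determines them. The closed form obeys the same recursion, because this transform sends
-- C(2k, k − i) to C(2N, N − 2i) and the weight G m = (2 − 2^(−v₂ m))·m satisfies
-- G (2j + 1) = 2j + 1 and G (2j) = 2j + G j.

module Submission where

open import Defs
open import Data.Nat using (ℕ)
open import Relation.Binary.PropositionalEquality using (_≡_)

open import Data.Bool using (Bool; true; false; if_then_else_; T?)
open import Data.Empty using (⊥-elim)
open import Data.Integer as ℤ using (ℤ; +_; -[1+_]; 0ℤ; 1ℤ; _+_; _*_; _-_; -_; _⊖_)
import Data.Integer.Properties as ℤ
open import Data.Integer.Tactic.RingSolver using (solve-∀)
open import Data.List using (List; []; _∷_; _++_; map; length; concat; concatMap; cartesianProductWith; applyUpTo; upTo; foldr)
open import Data.List.Membership.Propositional.Properties using (∈-filter⁺; ∈-upTo⁺)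
open import Data.List.Properties using (map-upTo; length-map; foldr-preservesᵇ; foldr-preservesᵒ)
open import Data.List.Relation.Unary.All as All using (All; []; _∷_)
open import Data.List.Relation.Unary.All.Properties using (concat⁺; map⁺; applyUpTo⁺₁; cartesianProductWith⁺; all-filter)
import Data.List.Relation.Unary.Any as Any
open import Data.Maybe using (just)
open import Data.Nat as ℕ using (zero; suc; _≤_; _<_; _∸_; _^_; _≡ᵇ_; _⊔_; z≤n; s≤s; z<s; s<s)
open import Data.Nat.Combinatorics using (_C_; nCk+nC[k+1]≡[n+1]C[k+1]; nCk≡nC[n∸k]; nC1≡n)
open import Data.Nat.Divisibility using (_∣_; divides; _∣?_; 1∣_; ∣-trans; m∣m*n; *-monoʳ-∣; *-cancelˡ-∣; ∣⇒≤)
open import Data.Nat.Induction using (<-rec)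
open import Data.Nat.ListAction using (sum)
import Data.Nat.Properties as ℕ
import Data.Nat.Tactic.RingSolver as ℕ-Solver
open import Data.Rational as ℚ using (ℚ; 0ℚ; 1ℚ; fromℚᵘ)
import Data.Rational.Properties as ℚ
open import Data.Rational.Solver using (module +-*-Solver)
open import Data.Rational.Unnormalised as ℚᵘ using (mkℚᵘ; *≡*)
import Data.Rational.Unnormalised.Properties as ℚᵘ
open import Data.Sum using (inj₂; [_,_]′)
open import Function using (_∘_)
open import Relation.Nullary using (¬_; yes; no)
open import Relation.Nullary.Decidable using (⌊_⌋; toWitness; fromWitness)
open import Relation.Binary.PropositionalEquality
open ≡-Reasoning
open import Algebra.Properties.CommutativeSemigroup ℤ.+-commutativeSemigroup using () renaming (interchange to +-interchange)

∑ : ℕ → (ℕ → ℤ) → ℤ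
∑ zero    F = 0ℤ
∑ (suc L) F = F 0 + ∑ L (λ i → F (suc i))

infixr 8 ∑
syntax ∑ L (λ i → F) = ∑[ i < L ] F

∑-cong-< : ∀ L {F G : ℕ → ℤ} → (∀ {i} → i < L → F i ≡ G i) → ∑ L F ≡ ∑ L G
∑-cong-< zero    eq = refl
∑-cong-< (suc L) eq = cong₂ _+_ (eq z<s) (∑-cong-< L (λ i<L → eq (s<s i<L)))

∑-cong : ∀ L {F G : ℕ → ℤ} → (∀ i → F i ≡ G i) → ∑ L F ≡ ∑ L G
∑-cong L eq = ∑-cong-< L (λ {i} _ → eq i)

∑-zero : ∀ L {F : ℕ → ℤ} → (∀ {i} → i < L → F i ≡ 0ℤ) → ∑ L F ≡ 0ℤ
∑-zero zero    eq = refl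
∑-zero (suc L) eq = cong₂ _+_ (eq z<s) (∑-zero L (λ i<L → eq (s<s i<L)))

∑-+ : ∀ L (F G : ℕ → ℤ) → ∑[ i < L ] (F i + G i) ≡ ∑ L F + ∑ L G
∑-+ zero    F G = refl
∑-+ (suc L) F G = trans (cong (_+_ (F 0 + G 0)) (∑-+ L _ _)) (+-interchange (F 0) (G 0) _ _)

∑-*ˡ : ∀ L c (F : ℕ → ℤ) → ∑[ i < L ] (c * F i) ≡ c * ∑ L F
∑-*ˡ zero    c F = sym (ℤ.*-zeroʳ c)
∑-*ˡ (suc L) c F = trans (cong (_+_ (c * F 0)) (∑-*ˡ L c _)) (sym (ℤ.*-distribˡ-+ c (F 0) _))

∑-*ʳ : ∀ L (F : ℕ → ℤ) c → ∑[ i < L ] (F i * c) ≡ ∑ L F * c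
∑-*ʳ L F c = trans (∑-cong L (λ i → ℤ.*-comm (F i) c)) (trans (∑-*ˡ L c F) (ℤ.*-comm c _))

∑-minus : ∀ L (F G : ℕ → ℤ) → ∑[ i < L ] (F i - G i) ≡ ∑ L F - ∑ L G
∑-minus zero    F G = refl
∑-minus (suc L) F G = trans (cong (_+_ (F 0 - G 0)) (∑-minus L _ _)) (interchange (F 0) (G 0) _ _)
  where
  interchange : ∀ a b c d → (a - b) + (c - d) ≡ (a + c) - (b + d)
  interchange = solve-∀

∑-c*[x+y] : ∀ L (c x y : ℕ → ℤ) → ∑[ k < L ] (c k * (x k + y k)) ≡ ∑[ k < L ] (c k * x k) + ∑[ k < L ] (c k * y k)
∑-c*[x+y] L c x y = trans (∑-cong L (λ k → ℤ.*-distribˡ-+ (c k) (x k) (y k))) (∑-+ L _ _)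

∑-[a+2b]*x : ∀ L (a b x : ℕ → ℤ) →
  ∑[ k < L ] ((a k + + 2 * b k) * x k) ≡ ∑[ k < L ] (a k * x k) + + 2 * ∑[ k < L ] (b k * x k)
∑-[a+2b]*x L a b x = begin
  ∑[ k < L ] ((a k + + 2 * b k) * x k)           ≡⟨ ∑-cong L (λ k → distrib (a k) (b k) (x k)) ⟩
  ∑[ k < L ] (a k * x k + + 2 * (b k * x k))     ≡⟨ ∑-+ L _ _ ⟩
  ∑[ k < L ] (a k * x k) + ∑[ k < L ] (+ 2 * (b k * x k))
    ≡⟨ cong (_+_ (∑[ k < L ] (a k * x k))) (∑-*ˡ L (+ 2) _) ⟩
  ∑[ k < L ] (a k * x k) + + 2 * ∑[ k < L ] (b k * x k) ∎
  where
  distrib : ∀ a b x → (a + + 2 * b) * x ≡ a * x + + 2 * (b * x)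
  distrib = solve-∀

∑-c*[x-2y+z] : ∀ L (c x y z : ℕ → ℤ) →
  ∑[ k < L ] (c k * (x k - + 2 * y k + z k)) ≡ ∑[ k < L ] (c k * x k) - + 2 * ∑[ k < L ] (c k * y k) + ∑[ k < L ] (c k * z k)
∑-c*[x-2y+z] L c x y z = begin
  ∑[ k < L ] (c k * (x k - + 2 * y k + z k))
    ≡⟨ ∑-cong L (λ k → distrib (c k) (x k) (y k) (z k)) ⟩
  ∑[ k < L ] (cx k - + 2 * cy k + cz k)
    ≡⟨ ∑-+ L (λ k → cx k - + 2 * cy k) cz ⟩
  ∑[ k < L ] (cx k - + 2 * cy k) + ∑ L cz
    ≡⟨ cong (λ s → s + ∑ L cz) (trans (∑-minus L cx (λ k → + 2 * cy k)) (cong (_-_ (∑ L cx)) (∑-*ˡ L (+ 2) cy))) ⟩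
  ∑ L cx - + 2 * ∑ L cy + ∑ L cz ∎
  where
  cx cy cz : ℕ → ℤ
  cx k = c k * x k
  cy k = c k * y k
  cz k = c k * z k
  distrib : ∀ c a b e → c * (a - + 2 * b + e) ≡ c * a - + 2 * (c * b) + c * e
  distrib = solve-∀

∑-snoc : ∀ L (F : ℕ → ℤ) → ∑ (suc L) F ≡ ∑ L F + F L
∑-snoc zero    F = trans (ℤ.+-identityʳ (F 0)) (sym (ℤ.+-identityˡ (F 0)))
∑-snoc (suc L) F = trans (cong (_+_ (F 0)) (∑-snoc L _)) (sym (ℤ.+-assoc (F 0) _ _))

∑-split : ∀ A B (F : ℕ → ℤ) → ∑ (A ℕ.+ B) F ≡ ∑ A F + ∑[ i < B ] F (A ℕ.+ i)
∑-split zero    B F = sym (ℤ.+-identityˡ _)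
∑-split (suc A) B F = trans (cong (_+_ (F 0)) (∑-split A B _)) (sym (ℤ.+-assoc (F 0) _ _))

∑-pad : ∀ {A B} (F : ℕ → ℤ) → A ≤ B → (∀ {i} → A ≤ i → i < B → F i ≡ 0ℤ) → ∑ B F ≡ ∑ A F
∑-pad {A} {B} F A≤B vanish = begin
  ∑ B F                                 ≡⟨ cong (λ L → ∑ L F) (sym (ℕ.m+[n∸m]≡n A≤B)) ⟩
  ∑ (A ℕ.+ (B ∸ A)) F                   ≡⟨ ∑-split A (B ∸ A) F ⟩
  ∑ A F + ∑[ i < B ∸ A ] F (A ℕ.+ i)    ≡⟨ cong (_+_ (∑ A F)) (∑-zero (B ∸ A) tail-vanishes) ⟩
  ∑ A F + 0ℤ                            ≡⟨ ℤ.+-identityʳ _ ⟩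
  ∑ A F                                 ∎
  where
  tail-vanishes : ∀ {i} → i < B ∸ A → F (A ℕ.+ i) ≡ 0ℤ
  tail-vanishes {i} i<B∸A = vanish (ℕ.m≤m+n A i) (subst (A ℕ.+ i <_) (ℕ.m+[n∸m]≡n A≤B) (ℕ.+-monoʳ-< A i<B∸A))

∑-comm : ∀ A B (F : ℕ → ℕ → ℤ) → ∑[ i < A ] ∑[ j < B ] F i j ≡ ∑[ j < B ] ∑[ i < A ] F i j
∑-comm zero    B F = sym (∑-zero B (λ _ → refl))
∑-comm (suc A) B F = trans (cong (_+_ (∑ B (F 0))) (∑-comm A B _)) (sym (∑-+ B (F 0) _))

∑-pairs : ∀ M (F : ℕ → ℤ) → ∑ (M ℕ.+ M) F ≡ ∑[ i < M ] (F (i ℕ.+ i) + F (suc (i ℕ.+ i)))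
∑-pairs zero    F = refl
∑-pairs (suc M) F = begin
  F 0 + ∑ (M ℕ.+ suc M) (λ i → F (suc i))
    ≡⟨ cong (λ L → F 0 + ∑ L (λ i → F (suc i))) (ℕ.+-suc M M) ⟩
  F 0 + (F 1 + ∑ (M ℕ.+ M) (λ i → F (suc (suc i))))
    ≡⟨ sym (ℤ.+-assoc (F 0) (F 1) _) ⟩
  F 0 + F 1 + ∑ (M ℕ.+ M) (λ i → F (suc (suc i)))
    ≡⟨ cong (_+_ (F 0 + F 1)) (∑-pairs M _) ⟩
  F 0 + F 1 + ∑[ i < M ] (F (2 ℕ.+ (i ℕ.+ i)) + F (3 ℕ.+ (i ℕ.+ i)))
    ≡⟨ cong (_+_ (F 0 + F 1)) (∑-cong M (λ i → cong₂ (λ a b → F a + F b) (reindex i) (cong suc (reindex i)))) ⟩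
  F 0 + F 1 + ∑[ i < M ] (F (suc i ℕ.+ suc i) + F (suc (suc i ℕ.+ suc i))) ∎
  where
  reindex : ∀ i → 2 ℕ.+ (i ℕ.+ i) ≡ suc i ℕ.+ suc i
  reindex i = cong suc (sym (ℕ.+-suc i i))

∑-triangle : ∀ L (F : ℕ → ℕ → ℤ) → ∑[ k < L ] ∑[ a < suc k ] F a (k ∸ a) ≡ ∑[ a < L ] ∑[ b < L ∸ a ] F a b
∑-triangle zero    F = refl
∑-triangle (suc L) F = begin
  ∑[ k < suc L ] ∑[ a < suc k ] F a (k ∸ a)
    ≡⟨ ∑-snoc L _ ⟩
  ∑[ k < L ] ∑[ a < suc k ] F a (k ∸ a) + ∑[ a < suc L ] F a (L ∸ a)
    ≡⟨ cong (_+ ∑[ a < suc L ] F a (L ∸ a)) (trans (∑-triangle L F) (sym drop-empty)) ⟩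
  ∑[ a < suc L ] ∑[ b < L ∸ a ] F a b + ∑[ a < suc L ] F a (L ∸ a)
    ≡⟨ sym (∑-+ (suc L) (λ a → ∑ (L ∸ a) (F a)) (λ a → F a (L ∸ a))) ⟩
  ∑[ a < suc L ] (∑[ b < L ∸ a ] F a b + F a (L ∸ a))
    ≡⟨ ∑-cong-< (suc L) (λ {a} a<1+L → trans (sym (∑-snoc (L ∸ a) (F a)))
                                             (cong (λ M → ∑ M (F a)) (sym (ℕ.+-∸-assoc 1 (ℕ.≤-pred a<1+L))))) ⟩
  ∑[ a < suc L ] ∑[ b < suc L ∸ a ] F a b ∎
  where
  drop-empty : ∑[ a < suc L ] ∑[ b < L ∸ a ] F a b ≡ ∑[ a < L ] ∑[ b < L ∸ a ] F a b
  drop-empty = trans (∑-snoc L (λ a → ∑ (L ∸ a) (F a)))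
    (trans (cong (λ M → ∑[ a < L ] ∑[ b < L ∸ a ] F a b + ∑ M (F L)) (ℕ.n∸n≡0 L)) (ℤ.+-identityʳ _))

∑ᴸ : {A : Set} → List A → (A → ℤ) → ℤ
∑ᴸ []       h = 0ℤ
∑ᴸ (x ∷ xs) h = h x + ∑ᴸ xs h

module _ {A : Set} where

  ∑ᴸ-cong : ∀ {xs : List A} {h h′ : A → ℤ} → All (λ x → h x ≡ h′ x) xs → ∑ᴸ xs h ≡ ∑ᴸ xs h′
  ∑ᴸ-cong []         = refl
  ∑ᴸ-cong (eq ∷ eqs) = cong₂ _+_ eq (∑ᴸ-cong eqs)

  ∑ᴸ-++ : ∀ (xs ys : List A) h → ∑ᴸ (xs ++ ys) h ≡ ∑ᴸ xs h + ∑ᴸ ys h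
  ∑ᴸ-++ []       ys h = sym (ℤ.+-identityˡ _)
  ∑ᴸ-++ (x ∷ xs) ys h = trans (cong (_+_ (h x)) (∑ᴸ-++ xs ys h)) (sym (ℤ.+-assoc (h x) _ _))

  ∑ᴸ-map : ∀ {B : Set} (f : B → A) xs h → ∑ᴸ (map f xs) h ≡ ∑ᴸ xs (h ∘ f)
  ∑ᴸ-map f []       h = refl
  ∑ᴸ-map f (x ∷ xs) h = cong (_+_ (h (f x))) (∑ᴸ-map f xs h)

  ∑ᴸ-concatMap : ∀ {B : Set} (F : B → List A) xs h → ∑ᴸ (concatMap F xs) h ≡ ∑ᴸ xs (λ x → ∑ᴸ (F x) h)
  ∑ᴸ-concatMap F []       h = refl
  ∑ᴸ-concatMap F (x ∷ xs) h = trans (∑ᴸ-++ (F x) _ h) (cong (_+_ (∑ᴸ (F x) h)) (∑ᴸ-concatMap F xs h))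

  ∑ᴸ-cartesianProductWith : ∀ {B C : Set} (f : B → C → A) xs ys h →
    ∑ᴸ (cartesianProductWith f xs ys) h ≡ ∑ᴸ xs (λ x → ∑ᴸ ys (λ y → h (f x y)))
  ∑ᴸ-cartesianProductWith f []       ys h = refl
  ∑ᴸ-cartesianProductWith f (x ∷ xs) ys h =
    trans (∑ᴸ-++ (map (f x) ys) _ h) (cong₂ _+_ (∑ᴸ-map (f x) ys h) (∑ᴸ-cartesianProductWith f xs ys h))

  ∑ᴸ-+ : ∀ (xs : List A) a b → ∑ᴸ xs (λ x → a x + b x) ≡ ∑ᴸ xs a + ∑ᴸ xs b
  ∑ᴸ-+ []       a b = refl
  ∑ᴸ-+ (x ∷ xs) a b = trans (cong (_+_ (a x + b x)) (∑ᴸ-+ xs a b)) (+-interchange (a x) (b x) _ _)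

  ∑ᴸ-*ˡ : ∀ (xs : List A) c a → ∑ᴸ xs (λ x → c * a x) ≡ c * ∑ᴸ xs a
  ∑ᴸ-*ˡ []       c a = sym (ℤ.*-zeroʳ c)
  ∑ᴸ-*ˡ (x ∷ xs) c a = trans (cong (_+_ (c * a x)) (∑ᴸ-*ˡ xs c a)) (sym (ℤ.*-distribˡ-+ c (a x) _))

  ∑ᴸ-∑ : ∀ (xs : List A) L (F : ℕ → A → ℤ) → ∑ᴸ xs (λ x → ∑[ k < L ] F k x) ≡ ∑[ k < L ] ∑ᴸ xs (F k)
  ∑ᴸ-∑ []       L F = sym (∑-zero L (λ _ → refl))
  ∑ᴸ-∑ (x ∷ xs) L F = trans (cong (_+_ (∑[ k < L ] F k x)) (∑ᴸ-∑ xs L F)) (sym (∑-+ L (λ k → F k x) _))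

∑ᴸ-applyUpTo : ∀ {A : Set} (f : ℕ → A) L h → ∑ᴸ (applyUpTo f L) h ≡ ∑[ i < L ] h (f i)
∑ᴸ-applyUpTo f zero    h = refl
∑ᴸ-applyUpTo f (suc L) h = cong (_+_ (h (f 0))) (∑ᴸ-applyUpTo (f ∘ suc) L h)

applyUpTo-cong : ∀ {A : Set} {f g : ℕ → A} L → (∀ {i} → i < L → f i ≡ g i) → applyUpTo f L ≡ applyUpTo g L
applyUpTo-cong zero    eq = refl
applyUpTo-cong (suc L) eq = cong₂ _∷_ (eq z<s) (applyUpTo-cong L (eq ∘ s<s))

treesF-fuel : ∀ {f g n} → n ≤ f → n ≤ g → treesF f n ≡ treesF g n
treesF-fuel {n = zero} _ _ = refl
treesF-fuel {suc f} {suc g} {suc n} (s≤s n≤f) (s≤s n≤g) =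
  cong concat (trans (map-upTo splitF (suc n)) (trans (applyUpTo-cong (suc n) splits-agree) (sym (map-upTo splitG (suc n)))))
  where
  splitF splitG : ℕ → List Tree
  splitF i = cartesianProductWith node (treesF f i) (treesF f (n ∸ i))
  splitG i = cartesianProductWith node (treesF g i) (treesF g (n ∸ i))
  splits-agree : ∀ {i} → i < suc n → splitF i ≡ splitG i
  splits-agree {i} (s≤s i≤n) = cong₂ (cartesianProductWith node)
    (treesF-fuel (ℕ.≤-trans i≤n n≤f) (ℕ.≤-trans i≤n n≤g))
    (treesF-fuel (ℕ.≤-trans (ℕ.m∸n≤m n i) n≤f) (ℕ.≤-trans (ℕ.m∸n≤m n i) n≤g))

treesF-size : ∀ f n → All (λ t → size t ≡ n) (treesF f n)
treesF-size f       zero    = refl ∷ []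
treesF-size zero    (suc n) = []
treesF-size (suc f) (suc n) = concat⁺ (map⁺ (applyUpTo⁺₁ (λ i → i) (suc n) λ {i} i<1+n →
  cartesianProductWith⁺ (setoid Tree) (setoid Tree) node (treesF f i) (treesF f (n ∸ i)) λ l∈ r∈ →
    cong suc (trans (cong₂ ℕ._+_ (All.lookup (treesF-size f i) l∈) (All.lookup (treesF-size f (n ∸ i)) r∈))
                    (ℕ.m+[n∸m]≡n (ℕ.≤-pred i<1+n)))))

ΣT : ℕ → (Tree → ℤ) → ℤ
ΣT n h = ∑ᴸ (trees n) h

ΣT-cong-size : ∀ n {h h′ : Tree → ℤ} → (∀ t → size t ≡ n → h t ≡ h′ t) → ΣT n h ≡ ΣT n h′
ΣT-cong-size n eq = ∑ᴸ-cong (All.map (eq _) (treesF-size n n))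

ΣT-cong : ∀ n {h h′ : Tree → ℤ} → (∀ t → h t ≡ h′ t) → ΣT n h ≡ ΣT n h′
ΣT-cong n eq = ΣT-cong-size n (λ t _ → eq t)

ΣT-node : ∀ n h → ΣT (suc n) h ≡ ∑[ i < suc n ] ΣT i (λ l → ΣT (n ∸ i) (λ r → h (node l r)))
ΣT-node n h = begin
  ∑ᴸ (concatMap split (upTo (suc n))) h                      ≡⟨ ∑ᴸ-concatMap split (upTo (suc n)) h ⟩
  ∑ᴸ (upTo (suc n)) (λ i → ∑ᴸ (split i) h)                   ≡⟨ ∑ᴸ-applyUpTo (λ i → i) (suc n) (λ i → ∑ᴸ (split i) h) ⟩
  ∑[ i < suc n ] ∑ᴸ (split i) h                              ≡⟨ ∑-cong-< (suc n) split-sum ⟩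
  ∑[ i < suc n ] ΣT i (λ l → ΣT (n ∸ i) (λ r → h (node l r))) ∎
  where
  split : ℕ → List Tree
  split i = cartesianProductWith node (treesF n i) (treesF n (n ∸ i))
  split-sum : ∀ {i} → i < suc n → ∑ᴸ (split i) h ≡ ΣT i (λ l → ΣT (n ∸ i) (λ r → h (node l r)))
  split-sum {i} (s≤s i≤n) rewrite treesF-fuel i≤n ℕ.≤-refl | treesF-fuel (ℕ.m∸n≤m n i) (ℕ.≤-refl {n ∸ i}) =
    ∑ᴸ-cartesianProductWith node (trees i) (trees (n ∸ i)) h

ΣT-+ : ∀ n (a b : Tree → ℤ) → ΣT n (λ t → a t + b t) ≡ ΣT n a + ΣT n b
ΣT-+ n = ∑ᴸ-+ (trees n)

ΣT-*ˡ : ∀ n c (a : Tree → ℤ) → ΣT n (λ t → c * a t) ≡ c * ΣT n a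
ΣT-*ˡ n = ∑ᴸ-*ˡ (trees n)

ΣT-∑ : ∀ n L (F : ℕ → Tree → ℤ) → ΣT n (λ t → ∑[ k < L ] F k t) ≡ ∑[ k < L ] ΣT n (F k)
ΣT-∑ n = ∑ᴸ-∑ (trees n)

ΣT-zero : ∀ h → ΣT 0 h ≡ h leaf
ΣT-zero h = ℤ.+-identityʳ (h leaf)

ΣT-cong-node : ∀ n {h h′ : Tree → ℤ} → (∀ l r → h (node l r) ≡ h′ (node l r)) → ΣT (suc n) h ≡ ΣT (suc n) h′
ΣT-cong-node n eq = ΣT-cong-size (suc n) (λ { leaf () ; (node l r) _ → eq l r })

ΣT-suc-suc : ∀ m h → ΣT (suc (suc m)) h ≡
  ΣT (suc m) (λ r → h (node leaf r))
  + (∑[ i < m ] ΣT (suc i) (λ l → ΣT (suc (m ∸ suc i)) (λ r → h (node l r)))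
  + ΣT (suc m) (λ l → h (node l leaf)))
ΣT-suc-suc m h = begin
  ΣT (suc (suc m)) h
    ≡⟨ ΣT-node (suc m) h ⟩
  part 0 + ∑[ i < suc m ] part (suc i)
    ≡⟨ cong₂ _+_ (ΣT-zero (λ l → ΣT (suc m) (λ r → h (node l r)))) (∑-snoc m (λ i → part (suc i))) ⟩
  ΣT (suc m) (λ r → h (node leaf r)) + (∑[ i < m ] part (suc i) + part (suc m))
    ≡⟨ cong (_+_ (ΣT (suc m) (λ r → h (node leaf r)))) (cong₂ _+_ (∑-cong-< m inner) last) ⟩
  ΣT (suc m) (λ r → h (node leaf r))
    + (∑[ i < m ] ΣT (suc i) (λ l → ΣT (suc (m ∸ suc i)) (λ r → h (node l r))) + ΣT (suc m) (λ l → h (node l leaf))) ∎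
  where
  part : ℕ → ℤ
  part i = ΣT i (λ l → ΣT (suc m ∸ i) (λ r → h (node l r)))
  inner : ∀ {i} → i < m → part (suc i) ≡ ΣT (suc i) (λ l → ΣT (suc (m ∸ suc i)) (λ r → h (node l r)))
  inner {i} i<m = cong (λ j → ΣT (suc i) (λ l → ΣT j (λ r → h (node l r)))) (ℕ.+-∸-assoc 1 i<m)
  last : part (suc m) ≡ ΣT (suc m) (λ l → h (node l leaf))
  last = ΣT-cong (suc m) (λ l → trans (cong (λ j → ΣT j (λ r → h (node l r))) (ℕ.n∸n≡0 m)) (ΣT-zero (λ r → h (node l r))))

∑ᴸ-+length : ∀ {A : Set} (xs : List A) → + length xs ≡ ∑ᴸ xs (λ _ → 1ℤ)
∑ᴸ-+length []       = refl
∑ᴸ-+length (x ∷ xs) = cong (_+_ 1ℤ) (∑ᴸ-+length xs)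

∑ᴸ-+sum : ∀ {A : Set} (f : A → ℕ) xs → + sum (map f xs) ≡ ∑ᴸ xs (λ x → + f x)
∑ᴸ-+sum f []       = refl
∑ᴸ-+sum f (x ∷ xs) = cong (_+_ (+ f x)) (∑ᴸ-+sum f xs)

-- Branches and the reduction of a tree
𝟙 : Bool → ℕ
𝟙 true  = 1
𝟙 false = 0

≡ᵇ-refl : ∀ n → (n ≡ᵇ n) ≡ true
≡ᵇ-refl zero    = refl
≡ᵇ-refl (suc n) = ≡ᵇ-refl n

combine : ℕ → ℕ → ℕ
combine a b = if a ≡ᵇ b then suc a else a ⊔ b

combine-suc : ∀ a b → suc (combine a b) ≡ combine (suc a) (suc b)
combine-suc a b with a ≡ᵇ b
... | true  = refl
... | false = refl

combine-hits-one : ∀ a b → 𝟙 (combine a b ≡ᵇ a) ℕ.+ 𝟙 (combine a b ≡ᵇ b) ℕ.+ 𝟙 (a ≡ᵇ b) ≡ 1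
combine-hits-one zero    zero    = refl
combine-hits-one zero    (suc b) rewrite ≡ᵇ-refl b = refl
combine-hits-one (suc a) zero    rewrite ≡ᵇ-refl a = refl
combine-hits-one (suc a) (suc b) with a ≡ᵇ b | combine-hits-one a b
... | true  | hits = hits
... | false | hits = hits

bottoms : Tree → ℕ
bottoms leaf       = 1
bottoms (node l r) = bottoms l ℕ.+ bottoms r ℕ.+ 𝟙 (Reg l ≡ᵇ Reg r)

branchTops-just : ∀ p t → branchTops (just p) t ℕ.+ 𝟙 (p ≡ᵇ Reg t) ≡ branches t
branchTops-just p leaf with p ≡ᵇ 0
... | true  = refl
... | false = refl
branchTops-just p (node l r) with p ≡ᵇ Reg (node l r)
... | true  = ℕ.+-comm _ 1
... | false = ℕ.+-comm _ 0

branches≡bottoms : ∀ t → branches t ≡ bottoms t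
branches≡bottoms leaf       = refl
branches≡bottoms (node l r) = begin
  1 ℕ.+ (x ℕ.+ y)                  ≡⟨ cong (ℕ._+ (x ℕ.+ y)) (sym (combine-hits-one (Reg l) (Reg r))) ⟩
  e₁ ℕ.+ e₂ ℕ.+ e ℕ.+ (x ℕ.+ y)    ≡⟨ regroup x y e₁ e₂ e ⟩
  (x ℕ.+ e₁) ℕ.+ (y ℕ.+ e₂) ℕ.+ e  ≡⟨ cong₂ (λ u v → u ℕ.+ v ℕ.+ e) (subtree l) (subtree r) ⟩
  bottoms l ℕ.+ bottoms r ℕ.+ e    ∎
  where
  R  = Reg (node l r)
  x  = branchTops (just R) l
  y  = branchTops (just R) r
  e₁ = 𝟙 (R ≡ᵇ Reg l)
  e₂ = 𝟙 (R ≡ᵇ Reg r)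
  e  = 𝟙 (Reg l ≡ᵇ Reg r)
  subtree : ∀ s → branchTops (just R) s ℕ.+ 𝟙 (R ≡ᵇ Reg s) ≡ bottoms s
  subtree s = trans (branchTops-just R s) (branches≡bottoms s)
  regroup : ∀ x y e₁ e₂ e → e₁ ℕ.+ e₂ ℕ.+ e ℕ.+ (x ℕ.+ y) ≡ (x ℕ.+ e₁) ℕ.+ (y ℕ.+ e₂) ℕ.+ e
  regroup = ℕ-Solver.solve-∀

reduce : Tree → Tree
reduce leaf                         = leaf
reduce (node leaf leaf)             = leaf
reduce (node leaf (node c d))       = reduce (node c d)
reduce (node (node a b) leaf)       = reduce (node a b)
reduce (node (node a b) (node c d)) = node (reduce (node a b)) (reduce (node c d))

Reg-reduce : ∀ l r → suc (Reg (reduce (node l r))) ≡ Reg (node l r)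
Reg-reduce leaf       leaf       = refl
Reg-reduce leaf       (node c d) = cong (combine 0) (Reg-reduce c d)
Reg-reduce (node a b) leaf       = cong (λ v → combine v 0) (Reg-reduce a b)
Reg-reduce (node a b) (node c d) = trans (combine-suc _ _) (cong₂ combine (Reg-reduce a b) (Reg-reduce c d))

bottoms-reduce : ∀ l r → bottoms (node l r) ≡ suc (size (node l r)) ℕ.+ bottoms (reduce (node l r))
bottoms-reduce leaf leaf = refl
bottoms-reduce leaf (node c d) = begin
  1 ℕ.+ bottoms t ℕ.+ 𝟙 (0 ≡ᵇ Reg t)
    ≡⟨ cong (λ v → 1 ℕ.+ bottoms t ℕ.+ 𝟙 (0 ≡ᵇ v)) (sym (Reg-reduce c d)) ⟩
  1 ℕ.+ bottoms t ℕ.+ 0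
    ≡⟨ cong (λ v → 1 ℕ.+ v ℕ.+ 0) (bottoms-reduce c d) ⟩
  1 ℕ.+ (suc (size t) ℕ.+ bottoms (reduce t)) ℕ.+ 0
    ≡⟨ regroup (size t) (bottoms (reduce t)) ⟩
  suc (size (node leaf t)) ℕ.+ bottoms (reduce t) ∎
  where
  t = node c d
  regroup : ∀ s x → 1 ℕ.+ (suc s ℕ.+ x) ℕ.+ 0 ≡ suc (suc s) ℕ.+ x
  regroup = ℕ-Solver.solve-∀
bottoms-reduce (node a b) leaf = begin
  bottoms t ℕ.+ 1 ℕ.+ 𝟙 (Reg t ≡ᵇ 0)
    ≡⟨ cong (λ v → bottoms t ℕ.+ 1 ℕ.+ 𝟙 (v ≡ᵇ 0)) (sym (Reg-reduce a b)) ⟩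
  bottoms t ℕ.+ 1 ℕ.+ 0
    ≡⟨ cong (λ v → v ℕ.+ 1 ℕ.+ 0) (bottoms-reduce a b) ⟩
  (suc (size t) ℕ.+ bottoms (reduce t)) ℕ.+ 1 ℕ.+ 0
    ≡⟨ regroup (size t) (bottoms (reduce t)) ⟩
  suc (size (node t leaf)) ℕ.+ bottoms (reduce t) ∎
  where
  t = node a b
  regroup : ∀ s x → (suc s ℕ.+ x) ℕ.+ 1 ℕ.+ 0 ≡ suc (suc (s ℕ.+ 0)) ℕ.+ x
  regroup = ℕ-Solver.solve-∀
bottoms-reduce (node a b) (node c d) = begin
  bottoms l ℕ.+ bottoms r ℕ.+ 𝟙 (Reg l ≡ᵇ Reg r)
    ≡⟨ cong₂ (λ u v → bottoms l ℕ.+ bottoms r ℕ.+ 𝟙 (u ≡ᵇ v)) (sym (Reg-reduce a b)) (sym (Reg-reduce c d)) ⟩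
  bottoms l ℕ.+ bottoms r ℕ.+ e
    ≡⟨ cong₂ (λ u v → u ℕ.+ v ℕ.+ e) (bottoms-reduce a b) (bottoms-reduce c d) ⟩
  (suc (size l) ℕ.+ bottoms (reduce l)) ℕ.+ (suc (size r) ℕ.+ bottoms (reduce r)) ℕ.+ e
    ≡⟨ regroup (size l) (size r) (bottoms (reduce l)) (bottoms (reduce r)) e ⟩
  suc (size (node l r)) ℕ.+ (bottoms (reduce l) ℕ.+ bottoms (reduce r) ℕ.+ e) ∎
  where
  l = node a b
  r = node c d
  e = 𝟙 (Reg (reduce l) ≡ᵇ Reg (reduce r))
  regroup : ∀ sl sr xl xr e → (suc sl ℕ.+ xl) ℕ.+ (suc sr ℕ.+ xr) ℕ.+ e ≡ suc (suc (sl ℕ.+ sr)) ℕ.+ (xl ℕ.+ xr ℕ.+ e)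
  regroup = ℕ-Solver.solve-∀

-- [zⁿ] (z/(1−2z))ᵃ: the number of trees of size n that reduce to a fixed tree with a nodes,
-- each node being preceded by a chain of unary nodes whose leaf may hang on either side.
expansions : ℕ → ℕ → ℤ
expansions zero    zero    = 1ℤ
expansions zero    (suc a) = 0ℤ
expansions (suc n) zero    = 0ℤ
expansions (suc n) (suc a) = expansions n a + + 2 * expansions n (suc a)

-- A tree of size k has 2k + 1 nodes.
fibre : ℕ → ℕ → ℤ
fibre n k = expansions n (suc (k ℕ.+ k))

expansions-vanish : ∀ {n a} → n < a → expansions n a ≡ 0ℤ
expansions-vanish {zero}  {suc a} _         = refl
expansions-vanish {suc n} {suc a} (s≤s n<a)
  rewrite expansions-vanish n<a | expansions-vanish (ℕ.m≤n⇒m≤1+n n<a) = refl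

expansions-conv : ∀ n a b → ∑[ i < suc n ] (expansions i a * expansions (n ∸ i) b) ≡ expansions n (a ℕ.+ b)
expansions-conv zero    zero    zero    = refl
expansions-conv zero    zero    (suc b) = refl
expansions-conv zero    (suc a) b       = refl
expansions-conv (suc n) zero    b       =
  trans (cong₂ _+_ (ℤ.*-identityˡ (expansions (suc n) b)) (∑-zero (suc n) (λ _ → refl))) (ℤ.+-identityʳ _)
expansions-conv (suc n) (suc a) b = begin
  0ℤ + ∑[ i < suc n ] ((expansions i a + + 2 * expansions i (suc a)) * expansions (n ∸ i) b)
    ≡⟨ ℤ.+-identityˡ _ ⟩
  ∑[ i < suc n ] ((expansions i a + + 2 * expansions i (suc a)) * expansions (n ∸ i) b)
    ≡⟨ ∑-[a+2b]*x (suc n) (λ i → expansions i a) (λ i → expansions i (suc a)) (λ i → expansions (n ∸ i) b) ⟩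
  _ ≡⟨ cong₂ (λ x y → x + + 2 * y) (expansions-conv n a b) (expansions-conv n (suc a) b) ⟩
  expansions n (a ℕ.+ b) + + 2 * expansions n (suc a ℕ.+ b) ∎

expansions-conv⁺ : ∀ m a b →
  ∑[ i < m ] (expansions (suc i) (suc a) * expansions (suc (m ∸ suc i)) (suc b)) ≡ expansions (suc m) (suc a ℕ.+ suc b)
expansions-conv⁺ m a b = begin
  ∑[ i < m ] (expansions (suc i) (suc a) * expansions (suc (m ∸ suc i)) (suc b))
    ≡⟨ ∑-cong-< m (λ {i} i<m → cong (λ j → expansions (suc i) (suc a) * expansions j (suc b)) (sym (ℕ.+-∸-assoc 1 i<m))) ⟩
  ∑ m (λ i → term (suc i))                ≡⟨ sym (ℤ.+-identityʳ _) ⟩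
  ∑ m (λ i → term (suc i)) + 0ℤ           ≡⟨ cong (_+_ (∑ m (λ i → term (suc i)))) (sym last-term) ⟩
  ∑ m (λ i → term (suc i)) + term (suc m) ≡⟨ sym (trans (ℤ.+-identityˡ _) (∑-snoc m (λ i → term (suc i)))) ⟩
  ∑ (suc (suc m)) term                    ≡⟨ expansions-conv (suc m) (suc a) (suc b) ⟩
  expansions (suc m) (suc a ℕ.+ suc b)    ∎
  where
  term : ℕ → ℤ
  term i = expansions i (suc a) * expansions (suc m ∸ i) (suc b)
  last-term : term (suc m) ≡ 0ℤ
  last-term = trans (cong (λ j → expansions (suc m) (suc a) * expansions j (suc b)) (ℕ.n∸n≡0 m)) (ℤ.*-zeroʳ (expansions (suc m) (suc a)))

-- Identities for the binomials C(2N, N − i)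
binomℤ-pascal : ∀ m j → binomℤ (suc m) (j + 1ℤ) ≡ binomℤ m j + binomℤ m (j + 1ℤ)
binomℤ-pascal m (+ k) rewrite ℕ.+-comm k 1 = cong +_ (sym (nCk+nC[k+1]≡[n+1]C[k+1] m k))
binomℤ-pascal m -[1+ 0 ]     = refl
binomℤ-pascal m -[1+ suc k ] = refl

W : ℤ → ℕ → ℤ
W i N = binomℤ (2 ℕ.* N) (+ N - i)

W-suc : ∀ i N → W i (suc N) ≡ W (i - 1ℤ) N + + 2 * W i N + W (i + 1ℤ) N
W-suc i N = begin
  binomℤ (2 ℕ.* suc N) (+ suc N - i)
    ≡⟨ cong₂ binomℤ (cong suc (ℕ.+-suc N (N ℕ.+ 0))) (ix₁ (+ N) i) ⟩
  binomℤ (suc (suc m)) (j + 1ℤ)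
    ≡⟨ binomℤ-pascal (suc m) j ⟩
  binomℤ (suc m) j + binomℤ (suc m) (j + 1ℤ)
    ≡⟨ cong (λ x → binomℤ (suc m) x + binomℤ (suc m) (j + 1ℤ)) (sym (ix₂ j)) ⟩
  binomℤ (suc m) (j - 1ℤ + 1ℤ) + binomℤ (suc m) (j + 1ℤ)
    ≡⟨ cong₂ _+_ (trans (binomℤ-pascal m (j - 1ℤ)) (cong (λ x → binomℤ m (j - 1ℤ) + binomℤ m x) (ix₂ j)))
                 (binomℤ-pascal m j) ⟩
  binomℤ m (j - 1ℤ) + binomℤ m j + (binomℤ m j + binomℤ m (j + 1ℤ))
    ≡⟨ regroup (binomℤ m (j - 1ℤ)) (binomℤ m j) (binomℤ m (j + 1ℤ)) ⟩
  binomℤ m (j + 1ℤ) + + 2 * binomℤ m j + binomℤ m (j - 1ℤ)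
    ≡⟨ cong₂ (λ x y → binomℤ m x + + 2 * W i N + binomℤ m y) (ix₃ (+ N) i) (ix₄ (+ N) i) ⟩
  W (i - 1ℤ) N + + 2 * W i N + W (i + 1ℤ) N ∎
  where
  m = 2 ℕ.* N
  j = + N - i
  ix₁ : ∀ n i → (1ℤ + n) - i ≡ (n - i) + 1ℤ
  ix₁ = solve-∀
  ix₂ : ∀ j → j - 1ℤ + 1ℤ ≡ j
  ix₂ = solve-∀
  ix₃ : ∀ n i → (n - i) + 1ℤ ≡ n - (i - 1ℤ)
  ix₃ = solve-∀
  ix₄ : ∀ n i → (n - i) - 1ℤ ≡ n - (i + 1ℤ)
  ix₄ = solve-∀
  regroup : ∀ a b c → a + b + (b + c) ≡ c + + 2 * b + a
  regroup = solve-∀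

W-vanish : ∀ {j N} → N < j → W (+ j) N ≡ 0ℤ
W-vanish {suc j} {N} (s≤s N≤j) =
  subst (λ d → binomℤ (2 ℕ.* N) (N ⊖ suc d) ≡ 0ℤ) (ℕ.m+[n∸m]≡n N≤j) (cong (binomℤ (2 ℕ.* N)) (⊖-negative N (j ∸ N)))
  where
  ⊖-negative : ∀ N d → N ⊖ suc (N ℕ.+ d) ≡ -[1+ d ]
  ⊖-negative zero    d = refl
  ⊖-negative (suc N) d = trans (ℤ.[1+m]⊖[1+n]≡m⊖n N (suc (N ℕ.+ d))) (⊖-negative N d)

C-reflect : ∀ {N} a b → a ℕ.+ b ≡ N → N C a ≡ N C b
C-reflect a b refl = trans (nCk≡nC[n∸k] (ℕ.m≤m+n a b)) (cong ((a ℕ.+ b) C_) (ℕ.m+n∸m≡n a b))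

C-pos : ∀ {m k} → k ≤ m → 0 < m C k
C-pos {m}     {zero}  _         = s≤s z≤n
C-pos {suc m} {suc k} (s≤s k≤m) = subst (0 <_) (nCk+nC[k+1]≡[n+1]C[k+1] m k) (ℕ.≤-trans (C-pos k≤m) (ℕ.m≤m+n _ _))

W-reflect : ∀ N → W -[1+ 0 ] N ≡ W 1ℤ N
W-reflect zero    = refl
W-reflect (suc N) = cong +_ (C-reflect (suc N ℕ.+ 1) N (split N))
  where
  split : ∀ N → suc N ℕ.+ 1 ℕ.+ N ≡ 2 ℕ.* suc N
  split = ℕ-Solver.solve-∀

W-size-zero : ∀ i → W i 0 ≡ W (i + i) 0
W-size-zero (+ zero)  = refl
W-size-zero (+ suc k) = refl
W-size-zero -[1+ k ]  = refl

W-size-zero-odd : ∀ i → W (i + i + 1ℤ) 0 ≡ 0ℤ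
W-size-zero-odd (+ k) rewrite ℕ.+-comm (k ℕ.+ k) 1 = refl
W-size-zero-odd -[1+ k ] = refl

fibre-W : ∀ {N L} → N < L → ∀ i → ∑[ k < L ] (fibre (suc N) k * W i k) ≡ W (i + i) N
fibre-W-odd : ∀ {N L} → N < L → ∀ i →
  ∑[ k < L ] (expansions (suc N) (suc (suc (k ℕ.+ k))) * (W i k + W (i + 1ℤ) k)) ≡ W (i + i + 1ℤ) N

fibre-W {zero} {suc L} _ i = begin
  1ℤ * W i 0 + ∑[ k < L ] (fibre 1 (suc k) * W i (suc k))
    ≡⟨ cong₂ _+_ (ℤ.*-identityˡ (W i 0)) (∑-zero L (λ _ → refl)) ⟩
  W i 0 + 0ℤ        ≡⟨ ℤ.+-identityʳ _ ⟩
  W i 0             ≡⟨ W-size-zero i ⟩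
  W (i + i) 0       ∎
fibre-W {suc N} {suc L} (s≤s N<L) i = begin
  ∑[ k < suc L ] (fibre (suc (suc N)) k * W i k)
    ≡⟨ ∑-[a+2b]*x (suc L) (λ k → expansions (suc N) (k ℕ.+ k)) (fibre (suc N)) (W i) ⟩
  ∑[ k < suc L ] (expansions (suc N) (k ℕ.+ k) * W i k) + + 2 * ∑[ k < suc L ] (fibre (suc N) k * W i k)
    ≡⟨ cong₂ (λ x y → x + + 2 * y) even-part (fibre-W (ℕ.m≤n⇒m≤1+n N<L) i) ⟩
  W (i + i - 1ℤ) N + W (i + i + 1ℤ) N + + 2 * W (i + i) N
    ≡⟨ regroup (W (i + i - 1ℤ) N) (W (i + i) N) (W (i + i + 1ℤ) N) ⟩
  W (i + i - 1ℤ) N + + 2 * W (i + i) N + W (i + i + 1ℤ) N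
    ≡⟨ sym (W-suc (i + i) N) ⟩
  W (i + i) (suc N) ∎
  where
  regroup : ∀ a b c → a + c + + 2 * b ≡ a + + 2 * b + c
  regroup = solve-∀
  even-part : ∑[ k < suc L ] (expansions (suc N) (k ℕ.+ k) * W i k) ≡ W (i + i - 1ℤ) N + W (i + i + 1ℤ) N
  even-part = begin
    0ℤ + ∑[ k < L ] (expansions (suc N) (suc k ℕ.+ suc k) * W i (suc k))
      ≡⟨ ℤ.+-identityˡ _ ⟩
    ∑[ k < L ] (expansions (suc N) (suc k ℕ.+ suc k) * W i (suc k))
      ≡⟨ ∑-cong L (λ k → cong₂ _*_ (cong (expansions (suc N)) (cong suc (ℕ.+-suc k k))) (W-suc-pairs k)) ⟩
    ∑[ k < L ] (expansions (suc N) (suc (suc (k ℕ.+ k))) * ((W (i - 1ℤ) k + W i k) + (W i k + W (i + 1ℤ) k)))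
      ≡⟨ ∑-c*[x+y] L (λ k → expansions (suc N) (suc (suc (k ℕ.+ k))))
                     (λ k → W (i - 1ℤ) k + W i k) (λ k → W i k + W (i + 1ℤ) k) ⟩
    _ ≡⟨ cong₂ _+_ (trans (cong (λ j → ∑[ k < L ] (expansions (suc N) (suc (suc (k ℕ.+ k))) * (W (i - 1ℤ) k + W j k))) (sym (ix i)))
                          (fibre-W-odd N<L (i - 1ℤ)))
                   (fibre-W-odd N<L i) ⟩
    W (i - 1ℤ + (i - 1ℤ) + 1ℤ) N + W (i + i + 1ℤ) N
      ≡⟨ cong (λ j → W j N + W (i + i + 1ℤ) N) (ix′ i) ⟩
    W (i + i - 1ℤ) N + W (i + i + 1ℤ) N ∎
    where
    ix : ∀ i → i - 1ℤ + 1ℤ ≡ i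
    ix = solve-∀
    ix′ : ∀ i → i - 1ℤ + (i - 1ℤ) + 1ℤ ≡ i + i - 1ℤ
    ix′ = solve-∀
    split : ∀ a b c → a + + 2 * b + c ≡ (a + b) + (b + c)
    split = solve-∀
    W-suc-pairs : ∀ k → W i (suc k) ≡ (W (i - 1ℤ) k + W i k) + (W i k + W (i + 1ℤ) k)
    W-suc-pairs k = trans (W-suc i k) (split (W (i - 1ℤ) k) (W i k) (W (i + 1ℤ) k))

fibre-W-odd {zero} {suc L} _ i = trans (∑-zero (suc L) (λ _ → refl)) (sym (W-size-zero-odd i))
fibre-W-odd {suc N} {suc L} (s≤s N<L) i = begin
  ∑[ k < suc L ] (expansions (suc (suc N)) (suc (suc (k ℕ.+ k))) * O k)
    ≡⟨ ∑-[a+2b]*x (suc L) (fibre (suc N)) (λ k → expansions (suc N) (suc (suc (k ℕ.+ k)))) O ⟩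
  ∑[ k < suc L ] (fibre (suc N) k * O k) + + 2 * ∑[ k < suc L ] (expansions (suc N) (suc (suc (k ℕ.+ k))) * O k)
    ≡⟨ cong (λ x → x + + 2 * ∑[ k < suc L ] (expansions (suc N) (suc (suc (k ℕ.+ k))) * O k))
            (∑-c*[x+y] (suc L) (fibre (suc N)) (W i) (W (i + 1ℤ))) ⟩
  _ ≡⟨ cong₂ (λ x y → x + + 2 * y) (cong₂ _+_ (fibre-W N<1+L i) (fibre-W N<1+L (i + 1ℤ))) (fibre-W-odd N<1+L i) ⟩
  W (i + i) N + W (i + 1ℤ + (i + 1ℤ)) N + + 2 * W (i + i + 1ℤ) N
    ≡⟨ cong₂ (λ x y → W x N + W y N + + 2 * W (i + i + 1ℤ) N) (sym (ix i)) (sym (ix′ i)) ⟩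
  W (i + i + 1ℤ - 1ℤ) N + W (i + i + 1ℤ + 1ℤ) N + + 2 * W (i + i + 1ℤ) N
    ≡⟨ regroup (W (i + i + 1ℤ - 1ℤ) N) (W (i + i + 1ℤ) N) (W (i + i + 1ℤ + 1ℤ) N) ⟩
  W (i + i + 1ℤ - 1ℤ) N + + 2 * W (i + i + 1ℤ) N + W (i + i + 1ℤ + 1ℤ) N
    ≡⟨ sym (W-suc (i + i + 1ℤ) N) ⟩
  W (i + i + 1ℤ) (suc N) ∎
  where
  O : ℕ → ℤ
  O k = W i k + W (i + 1ℤ) k
  N<1+L : N < suc L
  N<1+L = ℕ.m≤n⇒m≤1+n N<L
  ix : ∀ i → i + i + 1ℤ - 1ℤ ≡ i + i
  ix = solve-∀
  ix′ : ∀ i → i + i + 1ℤ + 1ℤ ≡ i + 1ℤ + (i + 1ℤ)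
  ix′ = solve-∀
  regroup : ∀ a b c → a + c + + 2 * b ≡ a + + 2 * b + c
  regroup = solve-∀

Δ : ℤ → ℕ → ℤ
Δ j k = W (j - 1ℤ) k - + 2 * W j k + W (j + 1ℤ) k

Δ-vanish : ∀ {i k} → k < i → Δ (+ suc i) k ≡ 0ℤ
Δ-vanish {i} {k} k<i
  rewrite W-vanish k<i | W-vanish (ℕ.m≤n⇒m≤1+n k<i) | ℕ.+-comm (suc i) 1
        | W-vanish (ℕ.m≤n⇒m≤1+n (ℕ.m≤n⇒m≤1+n k<i)) = refl

Δ-suc-even : ∀ j N → Δ (j + j) (suc N) ≡ W (j - 1ℤ + (j - 1ℤ)) N - + 2 * W (j + j) N + W (j + 1ℤ + (j + 1ℤ)) N
Δ-suc-even j N = trans (cong₂ _+_ (cong₂ (λ x y → x - + 2 * y) W₋ W₀) W₊) (collapse a b c d e)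
  where
  a = W (j - 1ℤ + (j - 1ℤ)) N
  b = W (j + j - 1ℤ) N
  c = W (j + j) N
  d = W (j + j + 1ℤ) N
  e = W (j + 1ℤ + (j + 1ℤ)) N
  ix₁ : ∀ j → j + j - 1ℤ - 1ℤ ≡ j - 1ℤ + (j - 1ℤ)
  ix₁ = solve-∀
  ix₂ : ∀ j → j + j - 1ℤ + 1ℤ ≡ j + j
  ix₂ = solve-∀
  ix₃ : ∀ j → j + j + 1ℤ - 1ℤ ≡ j + j
  ix₃ = solve-∀
  ix₄ : ∀ j → j + j + 1ℤ + 1ℤ ≡ j + 1ℤ + (j + 1ℤ)
  ix₄ = solve-∀
  W₋ : W (j + j - 1ℤ) (suc N) ≡ a + + 2 * b + c
  W₋ = trans (W-suc (j + j - 1ℤ) N) (cong₂ (λ x y → W x N + + 2 * b + W y N) (ix₁ j) (ix₂ j))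
  W₀ : W (j + j) (suc N) ≡ b + + 2 * c + d
  W₀ = W-suc (j + j) N
  W₊ : W (j + j + 1ℤ) (suc N) ≡ c + + 2 * d + e
  W₊ = trans (W-suc (j + j + 1ℤ) N) (cong₂ (λ x y → W x N + + 2 * d + W y N) (ix₃ j) (ix₄ j))
  collapse : ∀ a b c d e → (a + + 2 * b + c) - + 2 * (b + + 2 * c + d) + (c + + 2 * d + e) ≡ a - + 2 * c + e
  collapse = solve-∀

fibre-Δ : ∀ {N L} → N < L → ∀ j → ∑[ k < L ] (fibre (suc N) k * Δ j k) ≡ Δ (j + j) (suc N)
fibre-Δ {N} {L} N<L j = begin
  ∑[ k < L ] (fibre (suc N) k * Δ j k)
    ≡⟨ ∑-c*[x-2y+z] L (fibre (suc N)) (W (j - 1ℤ)) (W j) (W (j + 1ℤ)) ⟩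
  ∑[ k < L ] (fibre (suc N) k * W (j - 1ℤ) k) - + 2 * ∑[ k < L ] (fibre (suc N) k * W j k) + ∑[ k < L ] (fibre (suc N) k * W (j + 1ℤ) k)
    ≡⟨ cong₂ _+_ (cong₂ (λ x y → x - + 2 * y) (fibre-W N<L (j - 1ℤ)) (fibre-W N<L j)) (fibre-W N<L (j + 1ℤ)) ⟩
  W (j - 1ℤ + (j - 1ℤ)) N - + 2 * W (j + j) N + W (j + 1ℤ + (j + 1ℤ)) N
    ≡⟨ sym (Δ-suc-even j N) ⟩
  Δ (j + j) (suc N) ∎

∑-index*Δ : ∀ N → ∑[ i < suc N ] (+ suc i * Δ (+ suc i) N) ≡ W 0ℤ N
∑-index*Δ N = begin
  ∑[ i < suc N ] (+ suc i * Δ (+ suc i) N)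
    ≡⟨ partial (suc N) ⟩
  W 0ℤ N - W (+ suc N) N - + suc N * (W (+ suc N) N - W (+ suc (suc N)) N)
    ≡⟨ cong₂ (λ x y → W 0ℤ N - x - + suc N * (x - y))
             (W-vanish {suc N} ℕ.≤-refl) (W-vanish {suc (suc N)} (ℕ.m≤n⇒m≤1+n ℕ.≤-refl)) ⟩
  W 0ℤ N - 0ℤ - + suc N * (0ℤ - 0ℤ)
    ≡⟨ simplify (W 0ℤ N) (+ suc N) ⟩
  W 0ℤ N ∎
  where
  simplify : ∀ a m → a - 0ℤ - m * (0ℤ - 0ℤ) ≡ a
  simplify = solve-∀
  cancel : ∀ a b → 0ℤ ≡ a - a - 0ℤ * b
  cancel = solve-∀
  step : ∀ w a b c m → w - a - m * (a - b) + (1ℤ + m) * (a - + 2 * b + c) ≡ w - b - (1ℤ + m) * (b - c)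
  step = solve-∀
  partial : ∀ M → ∑[ i < M ] (+ suc i * Δ (+ suc i) N) ≡ W 0ℤ N - W (+ M) N - + M * (W (+ M) N - W (+ suc M) N)
  partial zero    = cancel (W 0ℤ N) (W 0ℤ N - W 1ℤ N)
  partial (suc M) = begin
    ∑[ i < suc M ] (+ suc i * Δ (+ suc i) N)
      ≡⟨ ∑-snoc M (λ i → + suc i * Δ (+ suc i) N) ⟩
    ∑[ i < M ] (+ suc i * Δ (+ suc i) N) + + suc M * Δ (+ suc M) N
      ≡⟨ cong₂ _+_ (partial M) (cong (λ x → + suc M * (W (+ M) N - + 2 * W (+ suc M) N + W x N)) (cong +_ (ℕ.+-comm (suc M) 1))) ⟩
    W 0ℤ N - W (+ M) N - + M * (W (+ M) N - W (+ suc M) N) + (1ℤ + + M) * (W (+ M) N - + 2 * W (+ suc M) N + W (+ suc (suc M)) N)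
      ≡⟨ step (W 0ℤ N) (W (+ M) N) (W (+ suc M) N) (W (+ suc (suc M)) N) (+ M) ⟩
    W 0ℤ N - W (+ suc M) N - + suc M * (W (+ suc M) N - W (+ suc (suc M)) N) ∎

-- The 2-adic valuation
n<2^n : ∀ n → n < 2 ^ n
n<2^n zero    = s≤s z≤n
n<2^n (suc n) = ℕ.≤-trans (s≤s (n<2^n n)) (ℕ.+-mono-≤ (ℕ.m^n>0 2 n) (ℕ.m≤m+n (2 ^ n) 0))

2^-mono-∣ : ∀ {a b} → a ≤ b → 2 ^ a ∣ 2 ^ b
2^-mono-∣ {a} {b} a≤b =
  subst (2 ^ a ∣_) (trans (sym (ℕ.^-distribˡ-+-* 2 a (b ∸ a))) (cong (2 ^_) (ℕ.m+[n∸m]≡n a≤b))) (m∣m*n (2 ^ (b ∸ a)))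

⊔-preserves : ∀ {P : ℕ → Set} {x y} → P x → P y → P (x ⊔ y)
⊔-preserves {P} {x} {y} px py = [ (λ eq → subst P (sym eq) px) , (λ eq → subst P (sym eq) py) ]′ (ℕ.⊔-sel x y)

v₂-divides : ∀ k → 2 ^ v₂ k ∣ k
v₂-divides k = foldr-preservesᵇ (λ {x} {y} → ⊔-preserves {λ ν → 2 ^ ν ∣ k} {x} {y}) (1∣ k)
  (All.map (λ {ν} → toWitness {a? = 2 ^ ν ∣? k}) (all-filter (T? ∘ λ ν → ⌊ 2 ^ ν ∣? k ⌋) (upTo (suc k))))

v₂-maximal : ∀ k {ν} → 2 ^ ν ∣ suc k → ν ≤ v₂ (suc k)
v₂-maximal k {ν} 2^ν∣k+1 = foldr-preservesᵒ (λ x y → [ ℕ.m≤n⇒m≤n⊔o y , ℕ.m≤n⇒m≤o⊔n x ]′) 0 _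
  (inj₂ (Any.map ℕ.≤-reflexive (∈-filter⁺ (T? ∘ λ ν → ⌊ 2 ^ ν ∣? suc k ⌋) (∈-upTo⁺ ν<k+2) (fromWitness 2^ν∣k+1))))
  where
  ν<k+2 : ν < suc (suc k)
  ν<k+2 = ℕ.≤-trans (n<2^n ν) (ℕ.≤-trans (∣⇒≤ 2^ν∣k+1) (ℕ.n≤1+n (suc k)))

v₂-unique : ∀ k v → 2 ^ v ∣ suc k → ¬ (2 ^ suc v ∣ suc k) → v₂ (suc k) ≡ v
v₂-unique k v 2^v∣k+1 2^v+1∤k+1 with v₂ (suc k) ℕ.≤? v
... | yes v₂≤v = ℕ.≤-antisym v₂≤v (v₂-maximal k 2^v∣k+1)
... | no  v₂≰v = ⊥-elim (2^v+1∤k+1 (∣-trans (2^-mono-∣ (ℕ.≰⇒> v₂≰v)) (v₂-divides (suc k))))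

odd≢even : ∀ j q → suc (j ℕ.+ j) ≢ q ℕ.* 2
odd≢even j       zero    ()
odd≢even zero    (suc q) ()
odd≢even (suc j) (suc q) eq =
  odd≢even j q (ℕ.suc-injective (ℕ.suc-injective (trans (cong (suc ∘ suc) (sym (ℕ.+-suc j j))) eq)))

v₂-odd : ∀ j → v₂ (suc (j ℕ.+ j)) ≡ 0
v₂-odd j = v₂-unique (j ℕ.+ j) 0 (1∣ _) (λ { (divides q eq) → odd≢even j q eq })

v₂-even : ∀ j → v₂ (suc j ℕ.+ suc j) ≡ suc (v₂ (suc j))
v₂-even j = v₂-unique (j ℕ.+ suc j) (suc v) 2^v+1∣2k 2^v+2∤2k
  where
  k = suc j
  v = v₂ k
  2*k≡k+k : 2 ℕ.* k ≡ k ℕ.+ k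
  2*k≡k+k = cong (ℕ._+_ k) (ℕ.+-identityʳ k)
  2^v+1∣2k : 2 ^ suc v ∣ k ℕ.+ k
  2^v+1∣2k = subst (2 ^ suc v ∣_) 2*k≡k+k (*-monoʳ-∣ 2 (v₂-divides k))
  2^v+2∤2k : ¬ (2 ^ suc (suc v) ∣ k ℕ.+ k)
  2^v+2∤2k 2^v+2∣2k = ℕ.1+n≰n (v₂-maximal j (*-cancelˡ-∣ 2 (subst (2 ^ suc (suc v) ∣_) (sym 2*k≡k+k) 2^v+2∣2k)))

oddPart : ℕ → ℕ
oddPart k = _∣_.quotient (v₂-divides k)

oddPart-spec : ∀ k → k ≡ oddPart k ℕ.* 2 ^ v₂ k
oddPart-spec k = _∣_.equality (v₂-divides k)

oddPart-odd : ∀ j → oddPart (suc (j ℕ.+ j)) ≡ suc (j ℕ.+ j)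
oddPart-odd j = sym (begin
  m                         ≡⟨ oddPart-spec m ⟩
  oddPart m ℕ.* 2 ^ v₂ m    ≡⟨ cong (λ v → oddPart m ℕ.* 2 ^ v) (v₂-odd j) ⟩
  oddPart m ℕ.* 1           ≡⟨ ℕ.*-identityʳ (oddPart m) ⟩
  oddPart m                 ∎)
  where m = suc (j ℕ.+ j)

oddPart-even : ∀ j → oddPart (suc j ℕ.+ suc j) ≡ oddPart (suc j)
oddPart-even j = ℕ.*-cancelʳ-≡ (oddPart (k ℕ.+ k)) (oddPart k) (2 ^ suc v) {{ℕ.m^n≢0 2 (suc v)}} (trans double-k (sym double-k′))
  where
  k = suc j
  v = v₂ k
  double-k : oddPart (k ℕ.+ k) ℕ.* 2 ^ suc v ≡ k ℕ.+ k
  double-k = trans (cong (λ w → oddPart (k ℕ.+ k) ℕ.* 2 ^ w) (sym (v₂-even j))) (sym (oddPart-spec (k ℕ.+ k)))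
  double-k′ : oddPart k ℕ.* 2 ^ suc v ≡ k ℕ.+ k
  double-k′ = trans (distrib (oddPart k) (2 ^ v)) (cong₂ ℕ._+_ (sym (oddPart-spec k)) (sym (oddPart-spec k)))
    where
    distrib : ∀ o p → o ℕ.* (2 ℕ.* p) ≡ o ℕ.* p ℕ.+ o ℕ.* p
    distrib = ℕ-Solver.solve-∀

-- G k = (2 − 2^(−v₂ k))·k, as oddPart k = k / 2^(v₂ k).
G : ℕ → ℤ
G k = + 2 * + k - + oddPart k

G-odd : ∀ j → G (suc (j ℕ.+ j)) ≡ + suc (j ℕ.+ j)
G-odd j = trans (cong (λ o → + 2 * + suc (j ℕ.+ j) - + o) (oddPart-odd j)) (2m-m (+ suc (j ℕ.+ j)))
  where
  2m-m : ∀ m → + 2 * m - m ≡ m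
  2m-m = solve-∀

G-even : ∀ j → G (suc j ℕ.+ suc j) ≡ + (suc j ℕ.+ suc j) + G (suc j)
G-even j = trans (cong (λ o → + 2 * + (suc j ℕ.+ suc j) - + o) (oddPart-even j)) (regroup (+ suc j) (+ oddPart (suc j)))
  where
  regroup : ∀ a o → + 2 * (a + a) - o ≡ (a + a) + (+ 2 * a - o)
  regroup = solve-∀

FibreRecursion : (ℕ → ℤ) → (ℕ → ℤ) → Set
FibreRecursion c a = ∀ N → a (suc N) ≡ c N + ∑[ k < suc N ] (fibre (suc N) k * a k)

fibreRecursion-unique : ∀ {c a b} → a 0 ≡ b 0 → FibreRecursion c a → FibreRecursion c b → ∀ n → a n ≡ b n
fibreRecursion-unique {c} {a} {b} a₀≡b₀ rec-a rec-b = <-rec (λ n → a n ≡ b n) step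
  where
  step : ∀ n → (∀ {m} → m < n → a m ≡ b m) → a n ≡ b n
  step zero    _  = a₀≡b₀
  step (suc N) IH = begin
    a (suc N)
      ≡⟨ rec-a N ⟩
    c N + ∑[ k < suc N ] (fibre (suc N) k * a k)
      ≡⟨ cong (_+_ (c N)) (∑-cong-< (suc N) (λ {k} k<1+N → cong (_*_ (fibre (suc N) k)) (IH k<1+N))) ⟩
    c N + ∑[ k < suc N ] (fibre (suc N) k * b k)
      ≡⟨ sym (rec-b N) ⟩
    b (suc N) ∎

closedForm : ℕ → ℤ
closedForm n = ∑[ i < suc n ] (G (suc i) * Δ (+ suc i) n)

closedForm-zero : closedForm 0 ≡ 1ℤ
closedForm-zero rewrite G-odd 0 = refl

closedForm-pad : ∀ {k N} → k ≤ N → closedForm k ≡ ∑[ i < suc N ] (G (suc i) * Δ (+ suc i) k)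
closedForm-pad {k} k≤N = sym (∑-pad (λ i → G (suc i) * Δ (+ suc i) k) (s≤s k≤N)
  (λ {i} k<i _ → trans (cong (_*_ (G (suc i))) (Δ-vanish k<i)) (ℤ.*-zeroʳ (G (suc i)))))

∑-fibre*closedForm : ∀ N →
  ∑[ k < suc N ] (fibre (suc N) k * closedForm k) ≡ ∑[ i < suc N ] (G (suc i) * Δ (+ suc i + + suc i) (suc N))
∑-fibre*closedForm N = begin
  ∑[ k < suc N ] (fibre (suc N) k * closedForm k)
    ≡⟨ ∑-cong-< (suc N) (λ {k} k<1+N → trans (cong (_*_ (fibre (suc N) k)) (closedForm-pad (ℕ.≤-pred k<1+N)))
                                              (sym (∑-*ˡ (suc N) (fibre (suc N) k) (λ i → G (suc i) * Δ (+ suc i) k)))) ⟩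
  ∑[ k < suc N ] ∑[ i < suc N ] (fibre (suc N) k * (G (suc i) * Δ (+ suc i) k))
    ≡⟨ ∑-comm (suc N) (suc N) (λ k i → fibre (suc N) k * (G (suc i) * Δ (+ suc i) k)) ⟩
  ∑[ i < suc N ] ∑[ k < suc N ] (fibre (suc N) k * (G (suc i) * Δ (+ suc i) k))
    ≡⟨ ∑-cong (suc N) (λ i → trans (∑-cong (suc N) (λ k → swap (fibre (suc N) k) (G (suc i)) (Δ (+ suc i) k)))
                                    (∑-*ˡ (suc N) (G (suc i)) (λ k → fibre (suc N) k * Δ (+ suc i) k))) ⟩
  ∑[ i < suc N ] (G (suc i) * ∑[ k < suc N ] (fibre (suc N) k * Δ (+ suc i) k))
    ≡⟨ ∑-cong (suc N) (λ i → cong (_*_ (G (suc i))) (fibre-Δ {N} ℕ.≤-refl (+ suc i))) ⟩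
  ∑[ i < suc N ] (G (suc i) * Δ (+ suc i + + suc i) (suc N)) ∎
  where
  swap : ∀ c g d → c * (g * d) ≡ g * (c * d)
  swap = solve-∀

∑-excess : ∀ N → ∑[ i < suc (suc N) ] ((G (suc i) - + suc i) * Δ (+ suc i) (suc N))
                 ≡ ∑[ i < suc N ] (G (suc i) * Δ (+ suc i + + suc i) (suc N))
∑-excess N = begin
  ∑[ i < suc (suc N) ] excess (suc i)
    ≡⟨ sym (∑-pad (λ i → excess (suc i)) (s≤s (ℕ.m≤n+m (suc N) N))
             (λ {i} N+1<i _ → trans (cong (_*_ (G (suc i) - + suc i)) (Δ-vanish N+1<i)) (ℤ.*-zeroʳ (G (suc i) - + suc i)))) ⟩
  ∑[ i < suc N ℕ.+ suc N ] excess (suc i)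
    ≡⟨ ∑-pairs (suc N) (λ i → excess (suc i)) ⟩
  ∑[ j < suc N ] (excess (suc (j ℕ.+ j)) + excess (suc (suc (j ℕ.+ j))))
    ≡⟨ ∑-cong (suc N) excess-pair ⟩
  ∑[ i < suc N ] (G (suc i) * Δ (+ suc i + + suc i) (suc N)) ∎
  where
  excess : ℕ → ℤ
  excess m = (G m - + m) * Δ (+ m) (suc N)
  vanish : ∀ m d → (m - m) * d ≡ 0ℤ
  vanish = solve-∀
  cancel : ∀ a g d → (a + g - a) * d ≡ g * d
  cancel = solve-∀
  excess-pair : ∀ j → excess (suc (j ℕ.+ j)) + excess (suc (suc (j ℕ.+ j))) ≡ G (suc j) * Δ (+ suc j + + suc j) (suc N)
  excess-pair j = begin
    excess (suc (j ℕ.+ j)) + excess (suc (suc (j ℕ.+ j)))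
      ≡⟨ cong₂ _+_ (trans (cong (λ g → (g - + suc (j ℕ.+ j)) * Δ (+ suc (j ℕ.+ j)) (suc N)) (G-odd j)) (vanish (+ suc (j ℕ.+ j)) _))
                   (cong excess (cong suc (sym (ℕ.+-suc j j)))) ⟩
    0ℤ + excess (suc j ℕ.+ suc j)
      ≡⟨ ℤ.+-identityˡ _ ⟩
    (G (suc j ℕ.+ suc j) - + (suc j ℕ.+ suc j)) * Δ (+ (suc j ℕ.+ suc j)) (suc N)
      ≡⟨ cong (λ g → (g - + (suc j ℕ.+ suc j)) * Δ (+ (suc j ℕ.+ suc j)) (suc N)) (G-even j) ⟩
    (+ (suc j ℕ.+ suc j) + G (suc j) - + (suc j ℕ.+ suc j)) * Δ (+ (suc j ℕ.+ suc j)) (suc N)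
      ≡⟨ cancel (+ (suc j ℕ.+ suc j)) (G (suc j)) (Δ (+ (suc j ℕ.+ suc j)) (suc N)) ⟩
    G (suc j) * Δ (+ suc j + + suc j) (suc N) ∎

-- Split G m = m + (G m − m): the first part telescopes to W 0 (N+1), and in the second the odd m
-- drop out while m = 2j contributes G j Δ (2j) (N+1), which is what the fibres produce from closedForm.
closedForm-recursion : FibreRecursion (λ N → W 0ℤ (suc N)) closedForm
closedForm-recursion N = begin
  ∑[ i < suc (suc N) ] (G (suc i) * Δ (+ suc i) (suc N))
    ≡⟨ ∑-cong (suc (suc N)) (λ i → split (G (suc i)) (+ suc i) (Δ (+ suc i) (suc N))) ⟩
  ∑[ i < suc (suc N) ] (+ suc i * Δ (+ suc i) (suc N) + (G (suc i) - + suc i) * Δ (+ suc i) (suc N))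
    ≡⟨ ∑-+ (suc (suc N)) (λ i → + suc i * Δ (+ suc i) (suc N)) (λ i → (G (suc i) - + suc i) * Δ (+ suc i) (suc N)) ⟩
  ∑[ i < suc (suc N) ] (+ suc i * Δ (+ suc i) (suc N)) + ∑[ i < suc (suc N) ] ((G (suc i) - + suc i) * Δ (+ suc i) (suc N))
    ≡⟨ cong₂ _+_ (∑-index*Δ (suc N)) (∑-excess N) ⟩
  W 0ℤ (suc N) + ∑[ i < suc N ] (G (suc i) * Δ (+ suc i + + suc i) (suc N))
    ≡⟨ cong (_+_ (W 0ℤ (suc N))) (sym (∑-fibre*closedForm N)) ⟩
  W 0ℤ (suc N) + ∑[ k < suc N ] (fibre (suc N) k * closedForm k) ∎
  where
  split : ∀ g s d → g * d ≡ s * d + (g - s) * d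
  split = solve-∀

-- Summing over trees through their reductions
ReduceFibres : ℕ → Set
ReduceFibres n = ∀ (g : Tree → ℤ) → ΣT (suc n) (λ t → g (reduce t)) ≡ ∑[ k < suc n ] (fibre (suc n) k * ΣT k g)

grafts : (Tree → ℤ) → ℕ → ℕ → ℤ
grafts g k₁ k₂ = ΣT k₁ (λ a → ΣT k₂ (λ b → g (node a b)))

fibre-vanish : ∀ {n k} → n < k → fibre (suc n) k ≡ 0ℤ
fibre-vanish {n} {k} n<k = expansions-vanish (s≤s (ℕ.≤-trans n<k (ℕ.m≤m+n k k)))

ΣT-reduce-both : ∀ {i q} m → i ≤ m → q ≤ m → ReduceFibres i → ReduceFibres q → ∀ g →
  ΣT (suc i) (λ l → ΣT (suc q) (λ r → g (reduce (node l r))))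
    ≡ ∑[ k₁ < suc m ] ∑[ k₂ < suc m ] (fibre (suc i) k₁ * fibre (suc q) k₂ * grafts g k₁ k₂)
ΣT-reduce-both {i} {q} m i≤m q≤m fibres-i fibres-q g = begin
  ΣT (suc i) (λ l → ΣT (suc q) (λ r → g (reduce (node l r))))
    ≡⟨ ΣT-cong-node i (λ a b → ΣT-cong-node q (λ c d → refl)) ⟩
  ΣT (suc i) (λ l → ΣT (suc q) (λ r → g (node (reduce l) (reduce r))))
    ≡⟨ ΣT-cong (suc i) (λ l → fibres-q (λ b → g (node (reduce l) b))) ⟩
  ΣT (suc i) (λ l → right (reduce l))
    ≡⟨ fibres-i right ⟩
  ∑[ k₁ < suc i ] (fibre (suc i) k₁ * ΣT k₁ right)
    ≡⟨ ∑-cong (suc i) expand ⟩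
  ∑[ k₁ < suc i ] ∑[ k₂ < suc q ] term k₁ k₂
    ≡⟨ sym (∑-pad (λ k₁ → ∑[ k₂ < suc q ] term k₁ k₂) (s≤s i≤m)
              (λ {k₁} i<k₁ _ → ∑-zero (suc q) (λ {k₂} _ →
                 cong (λ x → x * fibre (suc q) k₂ * grafts g k₁ k₂) (fibre-vanish i<k₁)))) ⟩
  ∑[ k₁ < suc m ] ∑[ k₂ < suc q ] term k₁ k₂
    ≡⟨ ∑-cong (suc m) (λ k₁ → sym (∑-pad (term k₁) (s≤s q≤m) (λ {k₂} q<k₂ _ →
         trans (cong (λ x → fibre (suc i) k₁ * x * grafts g k₁ k₂) (fibre-vanish q<k₂))
               (cong (_* grafts g k₁ k₂) (ℤ.*-zeroʳ (fibre (suc i) k₁)))))) ⟩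
  ∑[ k₁ < suc m ] ∑[ k₂ < suc m ] term k₁ k₂ ∎
  where
  term : ℕ → ℕ → ℤ
  term k₁ k₂ = fibre (suc i) k₁ * fibre (suc q) k₂ * grafts g k₁ k₂
  right : Tree → ℤ
  right a = ∑[ k₂ < suc q ] (fibre (suc q) k₂ * ΣT k₂ (λ b → g (node a b)))
  expand : ∀ k₁ → fibre (suc i) k₁ * ΣT k₁ right ≡ ∑[ k₂ < suc q ] term k₁ k₂
  expand k₁ = begin
    fibre (suc i) k₁ * ΣT k₁ right
      ≡⟨ cong (_*_ (fibre (suc i) k₁)) (ΣT-∑ k₁ (suc q) (λ k₂ a → fibre (suc q) k₂ * ΣT k₂ (λ b → g (node a b)))) ⟩
    fibre (suc i) k₁ * ∑[ k₂ < suc q ] ΣT k₁ (λ a → fibre (suc q) k₂ * ΣT k₂ (λ b → g (node a b)))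
      ≡⟨ cong (_*_ (fibre (suc i) k₁))
              (∑-cong (suc q) (λ k₂ → ΣT-*ˡ k₁ (fibre (suc q) k₂) (λ a → ΣT k₂ (λ b → g (node a b))))) ⟩
    fibre (suc i) k₁ * ∑[ k₂ < suc q ] (fibre (suc q) k₂ * grafts g k₁ k₂)
      ≡⟨ sym (∑-*ˡ (suc q) (fibre (suc i) k₁) (λ k₂ → fibre (suc q) k₂ * grafts g k₁ k₂)) ⟩
    ∑[ k₂ < suc q ] (fibre (suc i) k₁ * (fibre (suc q) k₂ * grafts g k₁ k₂))
      ≡⟨ ∑-cong (suc q) (λ k₂ → sym (ℤ.*-assoc (fibre (suc i) k₁) (fibre (suc q) k₂) (grafts g k₁ k₂))) ⟩
    ∑[ k₂ < suc q ] term k₁ k₂ ∎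

pairFibre : ℕ → ℕ → ℕ → ℤ
pairFibre m k₁ k₂ = expansions (suc m) (suc (k₁ ℕ.+ k₁) ℕ.+ suc (k₂ ℕ.+ k₂))

∑-ΣT-reduce-both : ∀ m → (∀ {j} → j < suc m → ReduceFibres j) → ∀ g →
  ∑[ i < m ] ΣT (suc i) (λ l → ΣT (suc (m ∸ suc i)) (λ r → g (reduce (node l r))))
    ≡ ∑[ k₁ < suc m ] ∑[ k₂ < suc m ] (pairFibre m k₁ k₂ * grafts g k₁ k₂)
∑-ΣT-reduce-both m fibres g = begin
  ∑[ i < m ] ΣT (suc i) (λ l → ΣT (suc (m ∸ suc i)) (λ r → g (reduce (node l r))))
    ≡⟨ ∑-cong-< m (λ {i} i<m → ΣT-reduce-both m (ℕ.<⇒≤ i<m) (ℕ.m∸n≤m m (suc i))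
                                 (fibres (ℕ.m≤n⇒m≤1+n i<m)) (fibres (s≤s (ℕ.m∸n≤m m (suc i)))) g) ⟩
  ∑[ i < m ] ∑[ k₁ < suc m ] ∑[ k₂ < suc m ] term i k₁ k₂
    ≡⟨ ∑-comm m (suc m) (λ i k₁ → ∑[ k₂ < suc m ] term i k₁ k₂) ⟩
  ∑[ k₁ < suc m ] ∑[ i < m ] ∑[ k₂ < suc m ] term i k₁ k₂
    ≡⟨ ∑-cong (suc m) (λ k₁ → ∑-comm m (suc m) (λ i k₂ → term i k₁ k₂)) ⟩
  ∑[ k₁ < suc m ] ∑[ k₂ < suc m ] ∑[ i < m ] term i k₁ k₂
    ≡⟨ ∑-cong (suc m) (λ k₁ → ∑-cong (suc m) (λ k₂ →
         trans (∑-*ʳ m (λ i → fibre (suc i) k₁ * fibre (suc (m ∸ suc i)) k₂) (grafts g k₁ k₂))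
               (cong (_* grafts g k₁ k₂) (expansions-conv⁺ m (k₁ ℕ.+ k₁) (k₂ ℕ.+ k₂))))) ⟩
  ∑[ k₁ < suc m ] ∑[ k₂ < suc m ] (pairFibre m k₁ k₂ * grafts g k₁ k₂) ∎
  where
  term : ℕ → ℕ → ℕ → ℤ
  term i k₁ k₂ = fibre (suc i) k₁ * fibre (suc (m ∸ suc i)) k₂ * grafts g k₁ k₂

∑-expansions-even : ∀ m g →
  ∑[ k < suc (suc m) ] (expansions (suc m) (k ℕ.+ k) * ΣT k g)
    ≡ ∑[ k₁ < suc m ] ∑[ k₂ < suc m ] (pairFibre m k₁ k₂ * grafts g k₁ k₂)
∑-expansions-even m g = begin
  0ℤ + ∑[ k < suc m ] (expansions (suc m) (suc k ℕ.+ suc k) * ΣT (suc k) g)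
    ≡⟨ ℤ.+-identityˡ _ ⟩
  ∑[ k < suc m ] (expansions (suc m) (suc k ℕ.+ suc k) * ΣT (suc k) g)
    ≡⟨ ∑-cong (suc m) (λ k → trans (cong (_*_ (expansions (suc m) (suc k ℕ.+ suc k))) (ΣT-node k g))
                                   (sym (∑-*ˡ (suc k) (expansions (suc m) (suc k ℕ.+ suc k)) (λ k₁ → grafts g k₁ (k ∸ k₁))))) ⟩
  ∑[ k < suc m ] ∑[ k₁ < suc k ] (expansions (suc m) (suc k ℕ.+ suc k) * grafts g k₁ (k ∸ k₁))
    ≡⟨ ∑-cong (suc m) (λ k → ∑-cong-< (suc k) (λ {k₁} k₁<1+k →
         cong (λ j → expansions (suc m) (suc j ℕ.+ suc j) * grafts g k₁ (k ∸ k₁)) (sym (ℕ.m+[n∸m]≡n (ℕ.≤-pred k₁<1+k))))) ⟩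
  ∑[ k < suc m ] ∑[ k₁ < suc k ] term k₁ (k ∸ k₁)
    ≡⟨ ∑-triangle (suc m) term ⟩
  ∑[ k₁ < suc m ] ∑[ k₂ < suc m ∸ k₁ ] term k₁ k₂
    ≡⟨ ∑-cong-< (suc m) (λ {k₁} k₁<1+m → sym (∑-pad (term k₁) (ℕ.m∸n≤m (suc m) k₁)
         (λ {k₂} m+1-k₁≤k₂ _ → cong (_* grafts g k₁ k₂) (expansions-vanish (too-big k₁<1+m m+1-k₁≤k₂))))) ⟩
  ∑[ k₁ < suc m ] ∑[ k₂ < suc m ] term k₁ k₂
    ≡⟨ ∑-cong (suc m) (λ k₁ → ∑-cong (suc m) (λ k₂ →
         cong (λ a → expansions (suc m) a * grafts g k₁ k₂) (regroup k₁ k₂))) ⟩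
  ∑[ k₁ < suc m ] ∑[ k₂ < suc m ] (pairFibre m k₁ k₂ * grafts g k₁ k₂) ∎
  where
  term : ℕ → ℕ → ℤ
  term k₁ k₂ = expansions (suc m) (suc (k₁ ℕ.+ k₂) ℕ.+ suc (k₁ ℕ.+ k₂)) * grafts g k₁ k₂
  regroup : ∀ k₁ k₂ → suc (k₁ ℕ.+ k₂) ℕ.+ suc (k₁ ℕ.+ k₂) ≡ suc (k₁ ℕ.+ k₁) ℕ.+ suc (k₂ ℕ.+ k₂)
  regroup = ℕ-Solver.solve-∀
  too-big : ∀ {k₁ k₂} → k₁ < suc m → suc m ∸ k₁ ≤ k₂ → suc m < suc (k₁ ℕ.+ k₂) ℕ.+ suc (k₁ ℕ.+ k₂)
  too-big {k₁} {k₂} k₁<1+m m+1-k₁≤k₂ = s≤s (ℕ.≤-trans m+1≤k₁+k₂ (ℕ.m≤m+n (k₁ ℕ.+ k₂) (suc (k₁ ℕ.+ k₂))))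
    where
    m+1≤k₁+k₂ : suc m ≤ k₁ ℕ.+ k₂
    m+1≤k₁+k₂ = subst (_≤ k₁ ℕ.+ k₂) (ℕ.m+[n∸m]≡n (ℕ.<⇒≤ k₁<1+m)) (ℕ.+-monoʳ-≤ k₁ m+1-k₁≤k₂)

ΣT-reduce : ∀ n → ReduceFibres n
ΣT-reduce = <-rec ReduceFibres step
  where
  step : ∀ n → (∀ {j} → j < n → ReduceFibres j) → ReduceFibres n
  step zero    _      g = sym (trans (ℤ.+-identityʳ _) (ℤ.*-identityˡ (ΣT 0 g)))
  step (suc m) fibres g = begin
    ΣT (suc (suc m)) (λ t → g (reduce t))
      ≡⟨ ΣT-suc-suc m (λ t → g (reduce t)) ⟩
    ΣT (suc m) (λ r → g (reduce (node leaf r))) + (middle + ΣT (suc m) (λ l → g (reduce (node l leaf))))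
      ≡⟨ cong₂ (λ x y → x + (middle + y)) (ΣT-cong-node m (λ _ _ → refl)) (ΣT-cong-node m (λ _ _ → refl)) ⟩
    ΣT (suc m) (λ t → g (reduce t)) + (middle + ΣT (suc m) (λ t → g (reduce t)))
      ≡⟨ cong₂ (λ x y → x + (y + x)) (fibres ℕ.≤-refl g) (∑-ΣT-reduce-both m fibres g) ⟩
    X + (M + X)
      ≡⟨ regroup X M ⟩
    M + + 2 * X
      ≡⟨ cong₂ (λ x y → x + + 2 * y) (sym (∑-expansions-even m g)) (sym (∑-pad (λ k → fibre (suc m) k * ΣT k g) (ℕ.n≤1+n (suc m))
            (λ {k} m<k _ → cong (_* ΣT k g) (fibre-vanish m<k)))) ⟩
    ∑[ k < suc (suc m) ] (expansions (suc m) (k ℕ.+ k) * ΣT k g) + + 2 * ∑[ k < suc (suc m) ] (fibre (suc m) k * ΣT k g)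
      ≡⟨ sym (∑-[a+2b]*x (suc (suc m)) (λ k → expansions (suc m) (k ℕ.+ k)) (fibre (suc m)) (λ k → ΣT k g)) ⟩
    ∑[ k < suc (suc m) ] (fibre (suc (suc m)) k * ΣT k g) ∎
    where
    middle = ∑[ i < m ] ΣT (suc i) (λ l → ΣT (suc (m ∸ suc i)) (λ r → g (reduce (node l r))))
    X = ∑[ k < suc m ] (fibre (suc m) k * ΣT k g)
    M = ∑[ k₁ < suc m ] ∑[ k₂ < suc m ] (pairFibre m k₁ k₂ * grafts g k₁ k₂)
    regroup : ∀ x m → x + (m + x) ≡ m + + 2 * x
    regroup = solve-∀

-- Counting trees and branches
catalan : ℕ → ℤ
catalan n = W 0ℤ n - W 1ℤ n

catalan-recursion : FibreRecursion (λ _ → 0ℤ) catalan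
catalan-recursion N = begin
  W 0ℤ (suc N) - W 1ℤ (suc N)
    ≡⟨ cong₂ _-_ (W-suc 0ℤ N) (W-suc 1ℤ N) ⟩
  (W -[1+ 0 ] N + + 2 * W 0ℤ N + W 1ℤ N) - (W 0ℤ N + + 2 * W 1ℤ N + W (+ 2) N)
    ≡⟨ cong (λ x → (x + + 2 * W 0ℤ N + W 1ℤ N) - (W 0ℤ N + + 2 * W 1ℤ N + W (+ 2) N)) (W-reflect N) ⟩
  (W 1ℤ N + + 2 * W 0ℤ N + W 1ℤ N) - (W 0ℤ N + + 2 * W 1ℤ N + W (+ 2) N)
    ≡⟨ collapse (W 1ℤ N) (W 0ℤ N) (W (+ 2) N) ⟩
  0ℤ + (W 0ℤ N - W (+ 2) N)
    ≡⟨ cong (_+_ 0ℤ) (sym (cong₂ _-_ (fibre-W {N} ℕ.≤-refl 0ℤ) (fibre-W {N} ℕ.≤-refl 1ℤ))) ⟩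
  0ℤ + (∑[ k < suc N ] (fibre (suc N) k * W 0ℤ k) - ∑[ k < suc N ] (fibre (suc N) k * W 1ℤ k))
    ≡⟨ cong (_+_ 0ℤ) (sym (∑-minus (suc N) (λ k → fibre (suc N) k * W 0ℤ k) (λ k → fibre (suc N) k * W 1ℤ k))) ⟩
  0ℤ + ∑[ k < suc N ] (fibre (suc N) k * W 0ℤ k - fibre (suc N) k * W 1ℤ k)
    ≡⟨ cong (_+_ 0ℤ) (∑-cong (suc N) (λ k → factor (fibre (suc N) k) (W 0ℤ k) (W 1ℤ k))) ⟩
  0ℤ + ∑[ k < suc N ] (fibre (suc N) k * catalan k) ∎
  where
  collapse : ∀ a b c → (a + + 2 * b + a) - (b + + 2 * a + c) ≡ 0ℤ + (b - c)
  collapse = solve-∀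
  factor : ∀ c x y → c * x - c * y ≡ c * (x - y)
  factor = solve-∀

ΣT-one : ∀ n → ΣT n (λ _ → 1ℤ) ≡ catalan n
ΣT-one = fibreRecursion-unique {c = λ _ → 0ℤ} refl (λ N → trans (ΣT-reduce N (λ _ → 1ℤ)) (sym (ℤ.+-identityˡ _))) catalan-recursion

*-C-absorb : ∀ m k → suc k ℕ.* (suc m C suc k) ≡ suc m ℕ.* (m C k)
*-C-absorb zero    zero    = refl
*-C-absorb zero    (suc k) = ℕ.*-zeroʳ (suc (suc k))
*-C-absorb (suc m) zero    = trans (ℕ.*-identityˡ _) (trans (nC1≡n (suc (suc m))) (sym (ℕ.*-identityʳ _)))
*-C-absorb (suc m) (suc k) = begin
  suc (suc k) ℕ.* (suc (suc m) C suc (suc k))     ≡⟨ cong (suc (suc k) ℕ.*_) (sym (nCk+nC[k+1]≡[n+1]C[k+1] (suc m) (suc k))) ⟩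
  suc (suc k) ℕ.* (c ℕ.+ d)                       ≡⟨ expand k c d ⟩
  c ℕ.+ suc k ℕ.* c ℕ.+ suc (suc k) ℕ.* d         ≡⟨ cong₂ (λ x y → c ℕ.+ x ℕ.+ y) (*-C-absorb m k) (*-C-absorb m (suc k)) ⟩
  c ℕ.+ suc m ℕ.* (m C k) ℕ.+ suc m ℕ.* (m C suc k) ≡⟨ factor c m (m C k) (m C suc k) ⟩
  c ℕ.+ suc m ℕ.* (m C k ℕ.+ m C suc k)           ≡⟨ cong (λ x → c ℕ.+ suc m ℕ.* x) (nCk+nC[k+1]≡[n+1]C[k+1] m k) ⟩
  c ℕ.+ suc m ℕ.* c                               ≡⟨ refl ⟩
  suc (suc m) ℕ.* c                               ∎
  where
  c = suc m C suc k
  d = suc m C suc (suc k)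
  expand : ∀ k c d → suc (suc k) ℕ.* (c ℕ.+ d) ≡ c ℕ.+ suc k ℕ.* c ℕ.+ suc (suc k) ℕ.* d
  expand = ℕ-Solver.solve-∀
  factor : ∀ c m a b → c ℕ.+ suc m ℕ.* a ℕ.+ suc m ℕ.* b ≡ c ℕ.+ suc m ℕ.* (a ℕ.+ b)
  factor = ℕ-Solver.solve-∀

double-suc : ∀ n → 2 ℕ.* suc n ≡ suc (suc (n ℕ.+ n))
double-suc = ℕ-Solver.solve-∀

central-ratio : ∀ n → suc (suc n) ℕ.* (2 ℕ.* suc n C n) ≡ suc n ℕ.* (2 ℕ.* suc n C suc n)
central-ratio n = subst (λ M → suc (suc n) ℕ.* (M C n) ≡ suc n ℕ.* (M C suc n)) (sym (double-suc n)) (begin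
  suc (suc n) ℕ.* (suc m C n)
    ≡⟨ cong (suc (suc n) ℕ.*_) (C-reflect n (suc (suc n)) (trans (ℕ.+-suc n (suc n)) (cong suc (ℕ.+-suc n n)))) ⟩
  suc (suc n) ℕ.* (suc m C suc (suc n))  ≡⟨ *-C-absorb m (suc n) ⟩
  suc m ℕ.* (m C suc n)                  ≡⟨ cong (suc m ℕ.*_) (C-reflect (suc n) n refl) ⟩
  suc m ℕ.* (m C n)                      ≡⟨ sym (*-C-absorb m n) ⟩
  suc n ℕ.* (suc m C suc n)              ∎)
  where
  m = suc (n ℕ.+ n)

catalan-closed : ∀ n → + suc n * catalan n ≡ W 0ℤ n
catalan-closed zero    = refl
catalan-closed (suc n) = begin
  + suc (suc n) * (W 0ℤ (suc n) - W 1ℤ (suc n))   ≡⟨ cong (λ w → + suc (suc n) * (w - W 1ℤ (suc n))) (W-zero (suc n)) ⟩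
  + suc (suc n) * (+ P - + Q)                     ≡⟨ distrib (+ suc (suc n)) (+ P) (+ Q) ⟩
  + suc (suc n) * + P - + suc (suc n) * + Q       ≡⟨ cong (_-_ (+ suc (suc n) * + P)) ratio ⟩
  (1ℤ + + suc n) * + P - + suc n * + P            ≡⟨ cancel (+ suc n) (+ P) ⟩
  + P                                             ≡⟨ sym (W-zero (suc n)) ⟩
  W 0ℤ (suc n)                                    ∎
  where
  P = 2 ℕ.* suc n C suc n
  Q = 2 ℕ.* suc n C n
  ratio : + suc (suc n) * + Q ≡ + suc n * + P
  ratio = trans (sym (ℤ.pos-* (suc (suc n)) Q)) (trans (cong +_ (central-ratio n)) (ℤ.pos-* (suc n) P))
  W-zero : ∀ N → W 0ℤ N ≡ + (2 ℕ.* N C N)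
  W-zero N = cong (binomℤ (2 ℕ.* N)) (ℤ.+-identityʳ (+ N))
  distrib : ∀ c x y → c * (x - y) ≡ c * x - c * y
  distrib = solve-∀
  cancel : ∀ m p → (1ℤ + m) * p - m * p ≡ p
  cancel = solve-∀

bottoms-recursion : FibreRecursion (λ N → W 0ℤ (suc N)) (λ n → ΣT n (λ t → + bottoms t))
bottoms-recursion N = begin
  ΣT (suc N) (λ t → + bottoms t)
    ≡⟨ ΣT-cong-size (suc N) (λ { leaf () ; (node l r) size≡ → split l r size≡ }) ⟩
  ΣT (suc N) (λ t → c * 1ℤ + + bottoms (reduce t))
    ≡⟨ ΣT-+ (suc N) (λ _ → c * 1ℤ) (λ t → + bottoms (reduce t)) ⟩
  ΣT (suc N) (λ _ → c * 1ℤ) + ΣT (suc N) (λ t → + bottoms (reduce t))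
    ≡⟨ cong₂ _+_ (ΣT-*ˡ (suc N) c (λ _ → 1ℤ)) (ΣT-reduce N (λ t → + bottoms t)) ⟩
  c * ΣT (suc N) (λ _ → 1ℤ) + ∑[ k < suc N ] (fibre (suc N) k * ΣT k (λ t → + bottoms t))
    ≡⟨ cong (λ x → x + ∑[ k < suc N ] (fibre (suc N) k * ΣT k (λ t → + bottoms t)))
            (trans (cong (_*_ c) (ΣT-one (suc N))) (catalan-closed (suc N))) ⟩
  W 0ℤ (suc N) + ∑[ k < suc N ] (fibre (suc N) k * ΣT k (λ t → + bottoms t)) ∎
  where
  c = + suc (suc N)
  split : ∀ l r → size (node l r) ≡ suc N → + bottoms (node l r) ≡ c * 1ℤ + + bottoms (reduce (node l r))
  split l r size≡ = begin
    + bottoms (node l r)                                 ≡⟨ cong +_ (bottoms-reduce l r) ⟩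
    + (suc (size (node l r)) ℕ.+ bottoms (reduce (node l r))) ≡⟨ cong (λ s → + (suc s ℕ.+ bottoms (reduce (node l r)))) size≡ ⟩
    c + + bottoms (reduce (node l r))                    ≡⟨ cong (_+ + bottoms (reduce (node l r))) (sym (ℤ.*-identityʳ c)) ⟩
    c * 1ℤ + + bottoms (reduce (node l r))               ∎

ΣT-bottoms : ∀ n → ΣT n (λ t → + bottoms t) ≡ closedForm n
ΣT-bottoms = fibreRecursion-unique {c = λ N → W 0ℤ (suc N)} (sym closedForm-zero) bottoms-recursion closedForm-recursion

+sum-branches≡closedForm : ∀ n → + sum (map branches (trees n)) ≡ closedForm n
+sum-branches≡closedForm n = trans (∑ᴸ-+sum branches (trees n)) (trans (ΣT-cong n (λ t → cong +_ (branches≡bottoms t))) (ΣT-bottoms n))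

length-trees : ∀ n → suc n ℕ.* length (trees n) ≡ 2 ℕ.* n C n
length-trees n = ℤ.+-injective (begin
  + (suc n ℕ.* length (trees n))  ≡⟨ ℤ.pos-* (suc n) (length (trees n)) ⟩
  + suc n * + length (trees n)    ≡⟨ cong (+ suc n *_) (trans (∑ᴸ-+length (trees n)) (ΣT-one n)) ⟩
  + suc n * catalan n             ≡⟨ catalan-closed n ⟩
  W 0ℤ n                          ≡⟨ cong (λ j → + (2 ℕ.* n C j)) (ℕ.+-identityʳ n) ⟩
  + (2 ℕ.* n C n)                 ∎)

-- Passing to ℚ
fromℚᵘ-+ : ∀ p q → fromℚᵘ (p ℚᵘ.+ q) ≡ fromℚᵘ p ℚ.+ fromℚᵘ q
fromℚᵘ-+ p q = ℚ.toℚᵘ-injective (ℚᵘ.≃-trans (ℚ.toℚᵘ-fromℚᵘ (p ℚᵘ.+ q))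
  (ℚᵘ.≃-sym (ℚᵘ.≃-trans (ℚ.toℚᵘ-homo-+ (fromℚᵘ p) (fromℚᵘ q))
                          (ℚᵘ.+-cong (ℚ.toℚᵘ-fromℚᵘ p) (ℚ.toℚᵘ-fromℚᵘ q)))))

fromℚᵘ-* : ∀ p q → fromℚᵘ (p ℚᵘ.* q) ≡ fromℚᵘ p ℚ.* fromℚᵘ q
fromℚᵘ-* p q = ℚ.toℚᵘ-injective (ℚᵘ.≃-trans (ℚ.toℚᵘ-fromℚᵘ (p ℚᵘ.* q))
  (ℚᵘ.≃-sym (ℚᵘ.≃-trans (ℚ.toℚᵘ-homo-* (fromℚᵘ p) (fromℚᵘ q))
                          (ℚᵘ.*-cong (ℚ.toℚᵘ-fromℚᵘ p) (ℚ.toℚᵘ-fromℚᵘ q)))))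

fromℚᵘ-neg : ∀ p → fromℚᵘ (ℚᵘ.- p) ≡ ℚ.- fromℚᵘ p
fromℚᵘ-neg p = ℚ.toℚᵘ-injective (ℚᵘ.≃-trans (ℚ.toℚᵘ-fromℚᵘ (ℚᵘ.- p))
  (ℚᵘ.≃-sym (ℚᵘ.≃-trans (ℚ.toℚᵘ-homo‿- (fromℚᵘ p)) (ℚᵘ.-‿cong (ℚ.toℚᵘ-fromℚᵘ p)))))

fromℤ : ℤ → ℚ
fromℤ z = z /ℕ 1

fromℤ-+ : ∀ x y → fromℤ (x + y) ≡ fromℤ x ℚ.+ fromℤ y
fromℤ-+ x y = trans (ℚ.fromℚᵘ-cong {mkℚᵘ (x + y) 0} {mkℚᵘ x 0 ℚᵘ.+ mkℚᵘ y 0} (*≡* (sym (lemma x y))))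
                    (fromℚᵘ-+ (mkℚᵘ x 0) (mkℚᵘ y 0))
  where
  lemma : ∀ x y → (x * + 1 + y * + 1) * + 1 ≡ (x + y) * + 1
  lemma = solve-∀

fromℤ-* : ∀ x y → fromℤ (x * y) ≡ fromℤ x ℚ.* fromℤ y
fromℤ-* x y = trans (ℚ.fromℚᵘ-cong {mkℚᵘ (x * y) 0} {mkℚᵘ x 0 ℚᵘ.* mkℚᵘ y 0} (*≡* refl))
                    (fromℚᵘ-* (mkℚᵘ x 0) (mkℚᵘ y 0))

fromℤ-minus : ∀ x y → fromℤ (x - y) ≡ fromℤ x ℚ.- fromℤ y
fromℤ-minus x y = trans (fromℤ-+ x (- y)) (cong (fromℤ x ℚ.+_) (fromℚᵘ-neg (mkℚᵘ y 0)))

1/[1+e]*[1+e] : ∀ e → ((+ 1) /ℕ suc e) ℚ.* fromℤ (+ suc e) ≡ 1ℚ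
1/[1+e]*[1+e] e = trans (sym (fromℚᵘ-* (mkℚᵘ 1ℤ e) (mkℚᵘ (+ suc e) 0)))
  (ℚ.fromℚᵘ-cong {mkℚᵘ 1ℤ e ℚᵘ.* mkℚᵘ (+ suc e) 0} {mkℚᵘ 1ℤ 0}
    (*≡* (trans (ℤ.*-identityʳ _) (cong (λ d → 1ℤ * + suc d) (sym (ℕ.*-identityʳ e))))))

/ℕ-rescale : ∀ z {m c C} → suc m ℕ.* c ≡ C → 0 ℕ.< C → z /ℕ c ≡ ((+ suc m) /ℕ C) ℚ.* fromℤ z
/ℕ-rescale z {m} {zero}  {C}     eq 0<C = ⊥-elim (ℕ.<-irrefl (trans (sym (ℕ.*-zeroʳ (suc m))) eq) 0<C)
/ℕ-rescale z {m} {suc c} {suc C} eq _   = trans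
  (ℚ.fromℚᵘ-cong {mkℚᵘ z c} {mkℚᵘ (+ suc m) C ℚᵘ.* mkℚᵘ z 0} (*≡* cross))
  (fromℚᵘ-* (mkℚᵘ (+ suc m) C) (mkℚᵘ z 0))
  where
  cross : z * + (suc C ℕ.* 1) ≡ (+ suc m * z) * + suc c
  cross = begin
    z * + (suc C ℕ.* 1)          ≡⟨ cong (λ d → z * + d) (trans (ℕ.*-identityʳ (suc C)) (sym eq)) ⟩
    z * + (suc m ℕ.* suc c)      ≡⟨ cong (z *_) (ℤ.pos-* (suc m) (suc c)) ⟩
    z * (+ suc m * + suc c)      ≡⟨ regroup z (+ suc m) (+ suc c) ⟩
    (+ suc m * z) * + suc c      ∎
    where
    regroup : ∀ z a b → z * (a * b) ≡ (a * z) * b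
    regroup = solve-∀

foldr-applyUpTo-fromℤ : ∀ m (g : ℕ → ℚ) (G : ℕ → ℤ) → (∀ i → g i ≡ fromℤ (G i)) →
  foldr ℚ._+_ 0ℚ (applyUpTo g m) ≡ fromℤ (∑ m G)
foldr-applyUpTo-fromℤ zero    g G eq = refl
foldr-applyUpTo-fromℤ (suc m) g G eq = trans
  (cong₂ ℚ._+_ (eq 0) (foldr-applyUpTo-fromℤ m (λ i → g (suc i)) (λ i → G (suc i)) (λ i → eq (suc i))))
  (sym (fromℤ-+ (G 0) _))

sumFrom1-fromℤ : ∀ m (f : ℕ → ℚ) (F : ℕ → ℤ) → (∀ k → f k ≡ fromℤ (F k)) →
  sumFrom1 m f ≡ fromℤ (∑[ i < m ] F (suc i))
sumFrom1-fromℤ m f F eq = trans (cong (foldr ℚ._+_ 0ℚ) (map-upTo (λ i → f (suc i)) m))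
  (foldr-applyUpTo-fromℤ m (λ i → f (suc i)) (λ i → F (suc i)) (λ i → eq (suc i)))

weight*k≡G : ∀ k → (((+ 2) /ℕ 1) ℚ.- ((+ 1) /ℕ (2 ^ v₂ k))) ℚ.* fromℤ (+ k) ≡ fromℤ (G k)
weight*k≡G k = begin
  (fromℤ (+ 2) ℚ.- (+ 1) /ℕ (2 ^ v₂ k)) ℚ.* fromℤ (+ k)
    ≡⟨ cong₂ (λ d x → (fromℤ (+ 2) ℚ.- (+ 1) /ℕ d) ℚ.* x) 2^v≡1+e k≡O*E ⟩
  (fromℤ (+ 2) ℚ.- B) ℚ.* (O ℚ.* E)
    ≡⟨ expand (fromℤ (+ 2)) B O E ⟩
  fromℤ (+ 2) ℚ.* (O ℚ.* E) ℚ.- (B ℚ.* E) ℚ.* O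
    ≡⟨ cong (λ b → fromℤ (+ 2) ℚ.* (O ℚ.* E) ℚ.- b ℚ.* O) (1/[1+e]*[1+e] e) ⟩
  fromℤ (+ 2) ℚ.* (O ℚ.* E) ℚ.- 1ℚ ℚ.* O
    ≡⟨ cong₂ (λ x y → fromℤ (+ 2) ℚ.* x ℚ.- y) (sym k≡O*E) (ℚ.*-identityˡ O) ⟩
  fromℤ (+ 2) ℚ.* fromℤ (+ k) ℚ.- O
    ≡⟨ sym (trans (fromℤ-minus (+ 2 * + k) (+ o)) (cong (ℚ._- O) (fromℤ-* (+ 2) (+ k)))) ⟩
  fromℤ (G k) ∎
  where
  o = oddPart k
  e = ℕ.pred (2 ^ v₂ k)
  2^v≡1+e : 2 ^ v₂ k ≡ suc e
  2^v≡1+e = sym (ℕ.suc-pred (2 ^ v₂ k) {{ℕ.m^n≢0 2 (v₂ k)}})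
  k≡o*2^v : + k ≡ + o * + suc e
  k≡o*2^v = trans (cong +_ (trans (oddPart-spec k) (cong (o ℕ.*_) 2^v≡1+e))) (ℤ.pos-* o (suc e))
  B = (+ 1) /ℕ suc e
  O = fromℤ (+ o)
  E = fromℤ (+ suc e)
  k≡O*E : fromℤ (+ k) ≡ O ℚ.* E
  k≡O*E = trans (cong fromℤ k≡o*2^v) (fromℤ-* (+ o) (+ suc e))
  expand : ∀ t b o e → (t ℚ.- b) ℚ.* (o ℚ.* e) ≡ t ℚ.* (o ℚ.* e) ℚ.- (b ℚ.* e) ℚ.* o
  expand = solve 4 (λ t b o e → (t :- b) :* (o :* e) := t :* (o :* e) :- (b :* e) :* o) refl
    where open +-*-Solver

summand≡fromℤ : ∀ n k → summand n k ≡ fromℤ (G k * Δ (+ k) n)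
summand≡fromℤ n k = begin
  weight ℚ.* fromℤ (+ k * D)                  ≡⟨ cong (weight ℚ.*_) (fromℤ-* (+ k) D) ⟩
  weight ℚ.* (fromℤ (+ k) ℚ.* fromℤ D)        ≡⟨ sym (ℚ.*-assoc weight (fromℤ (+ k)) (fromℤ D)) ⟩
  weight ℚ.* fromℤ (+ k) ℚ.* fromℤ D          ≡⟨ cong₂ ℚ._*_ (weight*k≡G k) (cong fromℤ D≡Δ) ⟩
  fromℤ (G k) ℚ.* fromℤ (Δ (+ k) n)           ≡⟨ sym (fromℤ-* (G k) (Δ (+ k) n)) ⟩
  fromℤ (G k * Δ (+ k) n)                     ∎
  where
  weight = ((+ 2) /ℕ 1) ℚ.- ((+ 1) /ℕ (2 ^ v₂ k))
  D = binomℤ (2 ℕ.* n) (+ suc n - + k) - + 2 * binomℤ (2 ℕ.* n) (+ n - + k) + binomℤ (2 ℕ.* n) (+ n - + 1 - + k)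
  ix₁ : ∀ a b → (1ℤ + a) - b ≡ a - (b - 1ℤ)
  ix₁ = solve-∀
  ix₂ : ∀ a b → a - 1ℤ - b ≡ a - (b + 1ℤ)
  ix₂ = solve-∀
  D≡Δ : D ≡ Δ (+ k) n
  D≡Δ = cong₂ (λ i j → binomℤ (2 ℕ.* n) i - + 2 * W (+ k) n + binomℤ (2 ℕ.* n) j) (ix₁ (+ n) (+ k)) (ix₂ (+ n) (+ k))

RHS≡closedForm : ∀ n → RHS n ≡ ((+ suc n) /ℕ (2 ℕ.* n C n)) ℚ.* fromℤ (closedForm n)
RHS≡closedForm n =
  cong (((+ suc n) /ℕ (2 ℕ.* n C n)) ℚ.*_) (sumFrom1-fromℤ (suc n) (summand n) (λ k → G k * Δ (+ k) n) (summand≡fromℤ n))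

corollary2p10 : (n : ℕ) → EX n ≡ RHS n
corollary2p10 n = begin
  EX n
    ≡⟨ cong₂ _/ℕ_ (+sum-branches≡closedForm n) (length-map branches (trees n)) ⟩
  closedForm n /ℕ length (trees n)
    ≡⟨ /ℕ-rescale (closedForm n) (length-trees n) (C-pos (ℕ.m≤m+n n (n ℕ.+ 0))) ⟩
  ((+ suc n) /ℕ (2 ℕ.* n C n)) ℚ.* fromℤ (closedForm n)
    ≡⟨ sym (RHS≡closedForm n) ⟩
  RHS n ∎
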